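{- For every positive integer $n$: if $n$ is odd then $a_1(n)=\frac{(n^2-1)(n^2+2n+3)}{16}$, and if $n$ is even then $a_1(n)=\frac{n(n+2)(n^2+2)}{16}$.
   Context: For a positive integer $n$, $T_n$ denotes the triangular lattice with $n$ rows: the set of points $\{a(1,0)+b(\tfrac12,\tfrac{\sqrt3}{2}) : a,b\in\mathbb{Z}_{\ge 0},\ a+b\le n-1\}$ in the plane. For an unordered pair $\{p_1,p_2\}$ of distinct points of $T_n$, the number of points $p_3\in T_n$ such that $p_1,p_2,p_3$ are the vertices of an equilateral triangle is $0$, $1$ or $2$. For $i\in\{0,1,2\}$, $a_i(n)$ denotes the number of unordered pairs of distinct points of $T_n$ for which this number equals $i$. -}

module Defs where

open import Data.Nat as ℕ using (ℕ; _∸_)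
open import Data.Integer as ℤ using (ℤ; +_; _-_)
open import Data.Product using (_×_; _,_)
open import Data.List using (List; []; _∷_; map; concatMap; upTo; filter; length; _++_)
open import Relation.Nullary.Decidable using (_×-dec_)

-- A point a·(1,0) + b·(1/2, √3/2) is represented by its lattice coordinates (a , b).
Point : Set
Point = ℕ × ℕ

points : ℕ → List Point
points n = concatMap (λ a → map (λ b → (a , b)) (upTo (n ∸ a))) (upTo n)

-- Squared Euclidean distance between two points in lattice coordinates:
-- |x(1,0) + y(1/2,√3/2)|² = x² + x y + y²  where (x , y) is the coordinate difference.
dist² : Point → Point → ℤ
dist² (a₁ , b₁) (a₂ , b₂) = x ℤ.* x ℤ.+ x ℤ.* y ℤ.+ y ℤ.* y
  where
    x = + a₁ - + a₂
    y = + b₁ - + b₂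

pairs : {A : Set} → List A → List (A × A)
pairs []       = []
pairs (x ∷ xs) = map (λ y → (x , y)) xs ++ pairs xs

thirdCount : ℕ → Point × Point → ℕ
thirdCount n (p₁ , p₂) =
  length (filter (λ p₃ → (dist² p₁ p₃ ℤ.≟ dist² p₁ p₂) ×-dec (dist² p₂ p₃ ℤ.≟ dist² p₁ p₂)) (points n))

a : ℕ → ℕ → ℕ
a i n = length (filter (λ pq → thirdCount n pq ℕ.≟ i) (pairs (points n)))

{-# OPTIONS --safe #-}
module Submission where

-- Points of T_n are written (a , b) in lattice coordinates, where the squared distance is the
-- norm form x² + xy + y², or (a , b , c) with a + b + c = n - 1 in barycentric coordinates.
-- For p ≠ q the third vertices of equilateral triangles on {p , q} are the apexes of the directed
-- edges p q and q p (the far endpoint turned by 60°), and they are distinct. The apex of p q lies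
-- in T_n iff q avoids three corner triangles of T_n, of sizes b, c and a; for the apex of q p the
-- sizes are c, a, b, and for both apexes they are max (b , c), max (c , a), max (a , b). With G, G′
-- the indicators of the two apexes, {p , q} is counted by a₁ iff G + G′ - 2 G G′ = 1, so 2 a₁(n)
-- is a sum over p of row sums, each an inclusion–exclusion count of corner triangles. Summing the
-- rows leaves sums over T_n of tri a, tri (min (a , b)) and tri (a - b - c - 1); the last two
-- agree, and their closed forms depend on the parity of n.

module Lattice where

  open import Data.Integer using (ℤ; +_; -[1+_]; 0ℤ; _+_; _-_; _*_; -_; ∣_∣; ≢-nonZero)
  open import Data.Integer.Properties
    using (+-0-abelianGroup; +-injective; pos-+; pos-*; +-identityʳ; +-comm; neg-involutive; ∣i∣≡0⇒i≡0;
           i*j≡0⇒i≡0∨j≡0; i-j≡0⇒i≡j; i≡j⇒i-j≡0; *-cancelˡ-≡)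
  open import Data.Integer.Tactic.RingSolver using (solve-∀)
  open import Algebra.Properties.AbelianGroup +-0-abelianGroup using (∙-cancelˡ)
  import Data.Nat as ℕ
  import Data.Nat.Properties as ℕ
  open import Data.Product using (_×_; _,_)
  open import Data.Sum using (_⊎_; inj₁; inj₂)
  open import Relation.Binary.PropositionalEquality
  open import Relation.Nullary using (¬_)

  norm² : ℤ → ℤ → ℤ
  norm² x y = x * x + x * y + y * y

  private
    square≡∣∣² : ∀ i → i * i ≡ + (∣ i ∣ ℕ.* ∣ i ∣)
    square≡∣∣² (+ ℕ.zero)  = refl
    square≡∣∣² (+ ℕ.suc n) = refl
    square≡∣∣² -[1+ n ]    = refl

    m*m≡0⇒m≡0 : ∀ m → m ℕ.* m ≡ 0 → m ≡ 0
    m*m≡0⇒m≡0 ℕ.zero _ = refl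

  norm²≡0⇒≡0 : ∀ x y → norm² x y ≡ 0ℤ → x ≡ 0ℤ × y ≡ 0ℤ
  norm²≡0⇒≡0 x y norm≡0 = x≡0 , y≡0
    where
    open ≡-Reasoning
    u : ℤ
    u = + 2 * x + y
    completed-square : ∀ x y → (+ 2 * x + y) * (+ 2 * x + y) + + 3 * (y * y) ≡ + 4 * (x * x + x * y + y * y)
    completed-square = solve-∀
    ∣u∣² ∣y∣² : ℕ.ℕ
    ∣u∣² = ∣ u ∣ ℕ.* ∣ u ∣
    ∣y∣² = ∣ y ∣ ℕ.* ∣ y ∣
    squares≡0 : ∣u∣² ℕ.+ 3 ℕ.* ∣y∣² ≡ 0
    squares≡0 = +-injective (begin
      + (∣u∣² ℕ.+ 3 ℕ.* ∣y∣²)  ≡⟨ pos-+ ∣u∣² (3 ℕ.* ∣y∣²) ⟩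
      + ∣u∣² + + (3 ℕ.* ∣y∣²)  ≡⟨ cong (λ v → + ∣u∣² + v) (pos-* 3 ∣y∣²) ⟩
      + ∣u∣² + + 3 * + ∣y∣²    ≡⟨ cong₂ (λ v w → v + + 3 * w) (sym (square≡∣∣² u)) (sym (square≡∣∣² y)) ⟩
      u * u + + 3 * (y * y)    ≡⟨ completed-square x y ⟩
      + 4 * norm² x y          ≡⟨ cong (+ 4 *_) norm≡0 ⟩
      0ℤ                       ∎)
    y≡0 : y ≡ 0ℤ
    y≡0 = ∣i∣≡0⇒i≡0 (m*m≡0⇒m≡0 ∣ y ∣ (ℕ.*-cancelˡ-≡ ∣y∣² 0 3 (ℕ.m+n≡0⇒n≡0 ∣u∣² squares≡0)))
    x≡0 : x ≡ 0ℤ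
    x≡0 = *-cancelˡ-≡ (+ 2) x 0ℤ (begin
      + 2 * x      ≡⟨ sym (+-identityʳ (+ 2 * x)) ⟩
      + 2 * x + 0ℤ ≡⟨ cong (λ v → + 2 * x + v) (sym y≡0) ⟩
      u            ≡⟨ ∣i∣≡0⇒i≡0 (m*m≡0⇒m≡0 ∣ u ∣ (ℕ.m+n≡0⇒m≡0 ∣u∣² squares≡0)) ⟩
      0ℤ           ∎)

  -- With L twice the inner product and K the cross product of (s , t) and (X , Y), polarization
  -- gives L = M, the identity L² + 3K² = 4 M · norm² s t then gives K = ± M, and (s , t) is
  -- recovered from L and K by Cramer's rule.
  third-vertex : ∀ X Y s t → ¬ (X ≡ 0ℤ × Y ≡ 0ℤ) →
    norm² s t ≡ norm² X Y → norm² (X - s) (Y - t) ≡ norm² X Y →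
    (s ≡ - Y × t ≡ X + Y) ⊎ (s ≡ X + Y × t ≡ - X)
  third-vertex X Y s t XY≢0 st≡M Xs≡M = rotation-by-sign K≡M⊎K≡-M
    where
    open ≡-Reasoning
    M L K : ℤ
    M = norm² X Y
    L = + 2 * s * X + s * Y + t * X + + 2 * t * Y
    K = X * t - Y * s

    polarization : ∀ X Y s t →
      ((X - s) * (X - s) + (X - s) * (Y - t) + (Y - t) * (Y - t)) + (+ 2 * s * X + s * Y + t * X + + 2 * t * Y)
        ≡ (s * s + s * t + t * t) + (X * X + X * Y + Y * Y)
    polarization = solve-∀
    lagrange : ∀ X Y s t →
      (+ 2 * s * X + s * Y + t * X + + 2 * t * Y) * (+ 2 * s * X + s * Y + t * X + + 2 * t * Y)
        + + 3 * ((X * t - Y * s) * (X * t - Y * s))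
        ≡ + 4 * (X * X + X * Y + Y * Y) * (s * s + s * t + t * t)
    lagrange = solve-∀
    cramer-s : ∀ X Y s t → + 2 * (X * X + X * Y + Y * Y) * s
      ≡ X * (+ 2 * s * X + s * Y + t * X + + 2 * t * Y) - (X + + 2 * Y) * (X * t - Y * s)
    cramer-s = solve-∀
    cramer-t : ∀ X Y s t → + 2 * (X * X + X * Y + Y * Y) * t
      ≡ Y * (+ 2 * s * X + s * Y + t * X + + 2 * t * Y) + (+ 2 * X + Y) * (X * t - Y * s)
    cramer-t = solve-∀
    difference-of-squares : ∀ K M → + 3 * ((K - M) * (K + M)) ≡ (M * M + + 3 * (K * K)) - (M * M + + 3 * (M * M))
    difference-of-squares = solve-∀
    four-squares : ∀ M → + 4 * M * M ≡ M * M + + 3 * (M * M)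
    four-squares = solve-∀

    L≡M : L ≡ M
    L≡M = ∙-cancelˡ M L M (begin
      M + L                     ≡⟨ cong (_+ L) (sym Xs≡M) ⟩
      norm² (X - s) (Y - t) + L ≡⟨ polarization X Y s t ⟩
      norm² s t + M             ≡⟨ cong (_+ M) st≡M ⟩
      M + M                     ∎)

    K≡M⊎K≡-M : K ≡ M ⊎ K ≡ - M
    K≡M⊎K≡-M = from-factors (i*j≡0⇒i≡0∨j≡0 (K - M) (*-cancelˡ-≡ (+ 3) ((K - M) * (K + M)) 0ℤ
      (trans (difference-of-squares K M) (i≡j⇒i-j≡0 (begin
        M * M + + 3 * (K * K) ≡⟨ cong (λ l → l * l + + 3 * (K * K)) (sym L≡M) ⟩
        L * L + + 3 * (K * K) ≡⟨ lagrange X Y s t ⟩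
        + 4 * M * norm² s t   ≡⟨ cong (+ 4 * M *_) st≡M ⟩
        + 4 * M * M           ≡⟨ four-squares M ⟩
        M * M + + 3 * (M * M) ∎)))))
      where
      from-factors : K - M ≡ 0ℤ ⊎ K + M ≡ 0ℤ → K ≡ M ⊎ K ≡ - M
      from-factors (inj₁ K-M≡0) = inj₁ (i-j≡0⇒i≡j K M K-M≡0)
      from-factors (inj₂ K+M≡0) = inj₂ (i-j≡0⇒i≡j K (- M) (trans (cong (λ m → K + m) (neg-involutive M)) K+M≡0))

    2M≢0 : + 2 * M ≢ 0ℤ
    2M≢0 2M≡0 = XY≢0 (norm²≡0⇒≡0 X Y (*-cancelˡ-≡ (+ 2) M 0ℤ 2M≡0))

    cancel : ∀ {v w} → + 2 * M * v ≡ + 2 * M * w → v ≡ w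
    cancel {v} {w} = *-cancelˡ-≡ (+ 2 * M) v w {{≢-nonZero 2M≢0}}

    solve-s : ∀ {k w} → K ≡ k → X * M - (X + + 2 * Y) * k ≡ + 2 * M * w → s ≡ w
    solve-s K≡k rotated = cancel (trans (cramer-s X Y s t)
      (trans (cong₂ (λ l k → X * l - (X + + 2 * Y) * k) L≡M K≡k) rotated))

    solve-t : ∀ {k w} → K ≡ k → Y * M + (+ 2 * X + Y) * k ≡ + 2 * M * w → t ≡ w
    solve-t K≡k rotated = cancel (trans (cramer-t X Y s t)
      (trans (cong₂ (λ l k → Y * l + (+ 2 * X + Y) * k) L≡M K≡k) rotated))

    rotate-s : ∀ X Y M → X * M - (X + + 2 * Y) * M ≡ + 2 * M * (- Y)
    rotate-s = solve-∀
    rotate-t : ∀ X Y M → Y * M + (+ 2 * X + Y) * M ≡ + 2 * M * (X + Y)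
    rotate-t = solve-∀
    rotate⁻¹-s : ∀ X Y M → X * M - (X + + 2 * Y) * (- M) ≡ + 2 * M * (X + Y)
    rotate⁻¹-s = solve-∀
    rotate⁻¹-t : ∀ X Y M → Y * M + (+ 2 * X + Y) * (- M) ≡ + 2 * M * (- X)
    rotate⁻¹-t = solve-∀

    rotation-by-sign : K ≡ M ⊎ K ≡ - M → (s ≡ - Y × t ≡ X + Y) ⊎ (s ≡ X + Y × t ≡ - X)
    rotation-by-sign (inj₁ K≡M)  = inj₁ (solve-s K≡M (rotate-s X Y M) , solve-t K≡M (rotate-t X Y M))
    rotation-by-sign (inj₂ K≡-M) = inj₂ (solve-s K≡-M (rotate⁻¹-s X Y M) , solve-t K≡-M (rotate⁻¹-t X Y M))

  norm²-swap : ∀ a b a′ b′ → norm² (a - a′) (b - b′) ≡ norm² (a′ - a) (b′ - b)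
  norm²-swap a b a′ b′ = identity a b a′ b′
    where
    identity : ∀ a b a′ b′ → (a - a′) * (a - a′) + (a - a′) * (b - b′) + (b - b′) * (b - b′)
                           ≡ (a′ - a) * (a′ - a) + (a′ - a) * (b′ - b) + (b′ - b) * (b′ - b)
    identity = solve-∀

  -- (x , y) - (a , b) is (a′ , b′) - (a , b) turned by 60°: (X , Y) ↦ (- Y , X + Y) in lattice coordinates.
  Apex : ℤ → ℤ → ℤ → ℤ → ℤ → ℤ → Set
  Apex a b a′ b′ x y = x + b′ ≡ a + b × y + a ≡ a′ + b′

  private
    from-difference : ∀ {i j k l} → i - j ≡ k - l → k ≡ l → i ≡ j
    from-difference {i} {j} d k≡l = i-j≡0⇒i≡j i j (trans d (i≡j⇒i-j≡0 k≡l))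

  equilateral⇒apex : ∀ a b a′ b′ x y → ¬ (a ≡ a′ × b ≡ b′) →
    norm² (a - x) (b - y) ≡ norm² (a - a′) (b - b′) → norm² (a′ - x) (b′ - y) ≡ norm² (a - a′) (b - b′) →
    Apex a b a′ b′ x y ⊎ Apex a′ b′ a b x y
  equilateral⇒apex a b a′ b′ x y p≢q pr≡pq qr≡pq = back-to-coordinates
    (third-vertex (a′ - a) (b′ - b) (x - a) (y - b) XY≢0
      (trans (sym (norm²-swap a b x y)) (trans pr≡pq (norm²-swap a b a′ b′)))
      (trans (cong₂ norm² (shift a′ x a) (shift b′ y b)) (trans qr≡pq (norm²-swap a b a′ b′))))
    where
    XY≢0 : ¬ (a′ - a ≡ 0ℤ × b′ - b ≡ 0ℤ)
    XY≢0 (X≡0 , Y≡0) = p≢q (sym (i-j≡0⇒i≡j a′ a X≡0) , sym (i-j≡0⇒i≡j b′ b Y≡0))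
    shift : ∀ i j k → (i - k) - (j - k) ≡ i - j
    shift = solve-∀
    ρ-x : ∀ x a b′ b → (x + b′) - (a + b) ≡ (x - a) - - (b′ - b)
    ρ-x = solve-∀
    ρ-y : ∀ y b a a′ b′ → (y + a) - (a′ + b′) ≡ (y - b) - ((a′ - a) + (b′ - b))
    ρ-y = solve-∀
    ρ⁻¹-x : ∀ x a b a′ b′ → (x + b) - (a′ + b′) ≡ (x - a) - ((a′ - a) + (b′ - b))
    ρ⁻¹-x = solve-∀
    ρ⁻¹-y : ∀ y b a′ a → (y + a′) - (a + b) ≡ (y - b) - - (a′ - a)
    ρ⁻¹-y = solve-∀
    back-to-coordinates :
      (x - a ≡ - (b′ - b) × y - b ≡ (a′ - a) + (b′ - b)) ⊎ (x - a ≡ (a′ - a) + (b′ - b) × y - b ≡ - (a′ - a)) →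
      Apex a b a′ b′ x y ⊎ Apex a′ b′ a b x y
    back-to-coordinates (inj₁ (s≡-Y , t≡X+Y)) =
      inj₁ (from-difference (ρ-x x a b′ b) s≡-Y , from-difference (ρ-y y b a a′ b′) t≡X+Y)
    back-to-coordinates (inj₂ (s≡X+Y , t≡-X)) =
      inj₂ (from-difference (ρ⁻¹-x x a b a′ b′) s≡X+Y , from-difference (ρ⁻¹-y y b a′ a) t≡-X)

  apex⇒equilateral : ∀ a b a′ b′ x y → Apex a b a′ b′ x y →
    norm² (a - x) (b - y) ≡ norm² (a - a′) (b - b′) × norm² (a′ - x) (b′ - y) ≡ norm² (a - a′) (b - b′)
  apex⇒equilateral a b a′ b′ x y (x+b′≡a+b , y+a≡a′+b′) =
    at-apex (from-difference (solved x b′ (a + b)) x+b′≡a+b) (from-difference (solved y a (a′ + b′)) y+a≡a′+b′)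
    where
    solved : ∀ x k m → x - (m - k) ≡ (x + k) - m
    solved = solve-∀
    side₁ : ∀ a b a′ b′ →
      (a - ((a + b) - b′)) * (a - ((a + b) - b′)) + (a - ((a + b) - b′)) * (b - ((a′ + b′) - a))
        + (b - ((a′ + b′) - a)) * (b - ((a′ + b′) - a))
      ≡ (a - a′) * (a - a′) + (a - a′) * (b - b′) + (b - b′) * (b - b′)
    side₁ = solve-∀
    side₂ : ∀ a b a′ b′ →
      (a′ - ((a + b) - b′)) * (a′ - ((a + b) - b′)) + (a′ - ((a + b) - b′)) * (b′ - ((a′ + b′) - a))
        + (b′ - ((a′ + b′) - a)) * (b′ - ((a′ + b′) - a))
      ≡ (a - a′) * (a - a′) + (a - a′) * (b - b′) + (b - b′) * (b - b′)
    side₂ = solve-∀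
    at-apex : ∀ {x y} → x ≡ (a + b) - b′ → y ≡ (a′ + b′) - a →
      norm² (a - x) (b - y) ≡ norm² (a - a′) (b - b′) × norm² (a′ - x) (b′ - y) ≡ norm² (a - a′) (b - b′)
    at-apex refl refl = side₁ a b a′ b′ , side₂ a b a′ b′

  degenerate⇒apex : ∀ a b x y → norm² (a - x) (b - y) ≡ norm² (a - a) (b - b) → Apex a b a b x y
  degenerate⇒apex a b x y pr≡0 = at-p (norm²≡0⇒≡0 (a - x) (b - y) (trans pr≡0 (zero-side a b)))
    where
    zero-side : ∀ a b → (a - a) * (a - a) + (a - a) * (b - b) + (b - b) * (b - b) ≡ 0ℤ
    zero-side = solve-∀
    at-p : a - x ≡ 0ℤ × b - y ≡ 0ℤ → Apex a b a b x y
    at-p (a-x≡0 , b-y≡0) =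
      cong (_+ b) (sym (i-j≡0⇒i≡j a x a-x≡0)) , trans (cong (_+ a) (sym (i-j≡0⇒i≡j b y b-y≡0))) (+-comm b a)

  apex-twice⇒≡ : ∀ a b a′ b′ x y → Apex a b a′ b′ x y → Apex a′ b′ a b x y → a ≡ a′ × b ≡ b′
  apex-twice⇒≡ a b a′ b′ x y (e₁ , e₂) (f₁ , f₂) = a≡a′ , b≡b′
    where
    d₁ d₂ : ℤ
    d₁ = ((x + b′) - (a + b)) - ((x + b) - (a′ + b′))
    d₂ = ((y + a) - (a′ + b′)) - ((y + a′) - (a + b))
    d₁≡0 : d₁ ≡ 0ℤ
    d₁≡0 = cong₂ _-_ (i≡j⇒i-j≡0 e₁) (i≡j⇒i-j≡0 f₁)
    d₂≡0 : d₂ ≡ 0ℤ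
    d₂≡0 = cong₂ _-_ (i≡j⇒i-j≡0 e₂) (i≡j⇒i-j≡0 f₂)
    3Y : ∀ a b a′ b′ x y → + 3 * (b′ - b)
      ≡ + 2 * (((x + b′) - (a + b)) - ((x + b) - (a′ + b′))) + (((y + a) - (a′ + b′)) - ((y + a′) - (a + b)))
    3Y = solve-∀
    3X : ∀ a b a′ b′ x y → + 3 * (a - a′)
      ≡ + 2 * (((y + a) - (a′ + b′)) - ((y + a′) - (a + b))) + (((x + b′) - (a + b)) - ((x + b) - (a′ + b′)))
    3X = solve-∀
    b≡b′ : b ≡ b′
    b≡b′ = sym (i-j≡0⇒i≡j b′ b (*-cancelˡ-≡ (+ 3) (b′ - b) 0ℤ
      (trans (3Y a b a′ b′ x y) (cong₂ (λ u v → + 2 * u + v) d₁≡0 d₂≡0))))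
    a≡a′ : a ≡ a′
    a≡a′ = i-j≡0⇒i≡j a a′ (*-cancelˡ-≡ (+ 3) (a - a′) 0ℤ
      (trans (3X a b a′ b′ x y) (cong₂ (λ u v → + 2 * u + v) d₂≡0 d₁≡0)))

open import Data.Bool using (if_then_else_)
open import Data.Empty using (⊥-elim)
open import Data.List using (List; []; _∷_; _++_; concatMap; upTo; applyUpTo; filter; length)
import Data.List as List
open import Data.List.Properties using (map-++; map-cong; map-∘; map-upTo)
open import Data.Nat
open import Data.Nat.DivMod using (m≡m%n+[m/n]*n)
open import Data.Nat.ListAction using (sum)
open import Data.Nat.ListAction.Properties using (sum-++)
open import Data.Nat.Properties
open import Data.Nat.Tactic.RingSolver using (solve-∀)
open import Algebra.Properties.CommutativeSemigroup +-commutativeSemigroup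
  using (interchange; x∙yz≈xz∙y; x∙yz≈zx∙y; xy∙z≈xz∙y; xy∙z≈yz∙x; xy∙z≈zy∙x)
open import Data.Product using (_×_; _,_; uncurry; proj₁; proj₂)
open import Data.Sum using (_⊎_; inj₁; inj₂)
import Data.Sum as Sum
open import Function.Bundles using (_⇔_; mk⇔; Equivalence)
open import Relation.Binary.PropositionalEquality
open import Relation.Nullary using (¬_; Dec; yes; no; does; contradiction)
open import Relation.Nullary.Decidable using (_×-dec_; ¬?)
import Data.Integer as ℤ
import Data.Integer.Properties as ℤ
open import Defs

⟦_⟧ : {P : Set} → Dec P → ℕ
⟦ d ⟧ = if does d then 1 else 0

⟦⟧-yes : {P : Set} (p : Dec P) → P → ⟦ p ⟧ ≡ 1
⟦⟧-yes (yes _) _ = refl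
⟦⟧-yes (no ¬p) p = ⊥-elim (¬p p)

⟦⟧-no : {P : Set} (p : Dec P) → ¬ P → ⟦ p ⟧ ≡ 0
⟦⟧-no (yes p) ¬p = ⊥-elim (¬p p)
⟦⟧-no (no _)  _  = refl

module _ {P Q : Set} where

  ⟦⟧-⇔ : (p : Dec P) (q : Dec Q) → P ⇔ Q → ⟦ p ⟧ ≡ ⟦ q ⟧
  ⟦⟧-⇔ (yes _) (yes _) _   = refl
  ⟦⟧-⇔ (yes p) (no ¬q) P⇔Q = ⊥-elim (¬q (Equivalence.to P⇔Q p))
  ⟦⟧-⇔ (no ¬p) (yes q) P⇔Q = ⊥-elim (¬p (Equivalence.from P⇔Q q))
  ⟦⟧-⇔ (no _)  (no _)  _   = refl

  ⟦⟧-× : (p : Dec P) (q : Dec Q) → ⟦ p ×-dec q ⟧ ≡ ⟦ p ⟧ * ⟦ q ⟧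
  ⟦⟧-× (yes _) (yes _) = refl
  ⟦⟧-× (yes _) (no _)  = refl
  ⟦⟧-× (no _)  _       = refl

  ⟦⟧-exactly-one : (p : Dec P) (q : Dec Q) → ⟦ ⟦ p ⟧ + ⟦ q ⟧ ≟ 1 ⟧ + 2 * (⟦ p ⟧ * ⟦ q ⟧) ≡ ⟦ p ⟧ + ⟦ q ⟧
  ⟦⟧-exactly-one (yes _) (yes _) = refl
  ⟦⟧-exactly-one (yes _) (no _)  = refl
  ⟦⟧-exactly-one (no _)  (yes _) = refl
  ⟦⟧-exactly-one (no _)  (no _)  = refl

⟦⟧-⊎ : {P A B : Set} (p : Dec P) (a : Dec A) (b : Dec B) → P ⇔ (A ⊎ B) → ¬ (A × B) → ⟦ p ⟧ ≡ ⟦ a ⟧ + ⟦ b ⟧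
⟦⟧-⊎ p (yes a) (yes b) _ ¬ab = ⊥-elim (¬ab (a , b))
⟦⟧-⊎ p (yes a) (no _)  P⇔A⊎B _ = ⟦⟧-yes p (Equivalence.from P⇔A⊎B (inj₁ a))
⟦⟧-⊎ p (no _)  (yes b) P⇔A⊎B _ = ⟦⟧-yes p (Equivalence.from P⇔A⊎B (inj₂ b))
⟦⟧-⊎ (yes p) (no ¬a) (no ¬b) P⇔A⊎B _ with Equivalence.to P⇔A⊎B p
... | inj₁ a = ⊥-elim (¬a a)
... | inj₂ b = ⊥-elim (¬b b)
⟦⟧-⊎ (no _) (no _) (no _) _ _ = refl

inclusion-exclusion₃ : {X Y Z : Set} (x : Dec X) (y : Dec Y) (z : Dec Z) → ¬ (X × Y × Z) →
  ⟦ ¬? x ×-dec ¬? y ×-dec ¬? z ⟧ + (⟦ x ⟧ + ⟦ y ⟧ + ⟦ z ⟧)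
    ≡ 1 + (⟦ y ⟧ * ⟦ z ⟧ + ⟦ z ⟧ * ⟦ x ⟧ + ⟦ x ⟧ * ⟦ y ⟧)
inclusion-exclusion₃ (yes x) (yes y) (yes z) ¬xyz = ⊥-elim (¬xyz (x , y , z))
inclusion-exclusion₃ (yes _) (yes _) (no _)  _ = refl
inclusion-exclusion₃ (yes _) (no _)  (yes _) _ = refl
inclusion-exclusion₃ (yes _) (no _)  (no _)  _ = refl
inclusion-exclusion₃ (no _)  (yes _) (yes _) _ = refl
inclusion-exclusion₃ (no _)  (yes _) (no _)  _ = refl
inclusion-exclusion₃ (no _)  (no _)  (yes _) _ = refl
inclusion-exclusion₃ (no _)  (no _)  (no _)  _ = refl

module _ {A : Set} where

  length-filter≡sum : {P : A → Set} (P? : ∀ x → Dec (P x)) (xs : List A) →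
    length (filter P? xs) ≡ sum (List.map (λ x → ⟦ P? x ⟧) xs)
  length-filter≡sum P? []       = refl
  length-filter≡sum P? (x ∷ xs) with P? x
  ... | yes _ = cong suc (length-filter≡sum P? xs)
  ... | no _  = length-filter≡sum P? xs

  sum-map-+ : (f g : A → ℕ) (xs : List A) →
    sum (List.map (λ x → f x + g x) xs) ≡ sum (List.map f xs) + sum (List.map g xs)
  sum-map-+ f g []       = refl
  sum-map-+ f g (x ∷ xs) = trans (cong (f x + g x +_) (sum-map-+ f g xs)) (interchange (f x) (g x) _ _)

  sum-map-concatMap : {B : Set} (f : B → ℕ) (g : A → List B) (xs : List A) →
    sum (List.map f (concatMap g xs)) ≡ sum (List.map (λ x → sum (List.map f (g x))) xs)
  sum-map-concatMap f g []       = refl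
  sum-map-concatMap f g (x ∷ xs) = begin
    sum (List.map f (g x ++ concatMap g xs))                   ≡⟨ cong sum (map-++ f (g x) (concatMap g xs)) ⟩
    sum (List.map f (g x) ++ List.map f (concatMap g xs))      ≡⟨ sum-++ (List.map f (g x)) _ ⟩
    sum (List.map f (g x)) + sum (List.map f (concatMap g xs)) ≡⟨ cong (sum (List.map f (g x)) +_) (sum-map-concatMap f g xs) ⟩
    sum (List.map f (g x)) + sum (List.map (λ x → sum (List.map f (g x))) xs) ∎
    where open ≡-Reasoning

  sum-pairs : (Q : A → A → ℕ) → (∀ x y → Q x y ≡ Q y x) → ∀ xs →
    2 * sum (List.map (uncurry Q) (pairs xs)) + sum (List.map (λ x → Q x x) xs)
      ≡ sum (List.map (λ x → sum (List.map (Q x) xs)) xs)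
  sum-pairs Q Q-comm []       = refl
  sum-pairs Q Q-comm (x ∷ xs) = begin
    2 * P (x ∷ xs) + (Q x x + D)               ≡⟨ cong (λ p → 2 * p + (Q x x + D)) first-row ⟩
    2 * (R x + P xs) + (Q x x + D)             ≡⟨ regroup (Q x x) (R x) (P xs) D ⟩
    Q x x + R x + (R x + (2 * P xs + D))       ≡⟨ cong (λ s → Q x x + R x + (R x + s)) (sum-pairs Q Q-comm xs) ⟩
    Q x x + R x + (R x + S)                    ≡⟨ cong (λ r → Q x x + R x + (r + S)) (cong sum (map-cong (Q-comm x) xs)) ⟩
    Q x x + R x + (sum (List.map (λ y → Q y x) xs) + S)
                                               ≡⟨ cong (Q x x + R x +_) (sym (sum-map-+ (λ y → Q y x) R xs)) ⟩
    sum (List.map (λ y → sum (List.map (Q y) (x ∷ xs))) (x ∷ xs)) ∎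
    where
    open ≡-Reasoning
    P : List A → ℕ
    P ys = sum (List.map (uncurry Q) (pairs ys))
    R : A → ℕ
    R y = sum (List.map (Q y) xs)
    D S : ℕ
    D = sum (List.map (λ y → Q y y) xs)
    S = sum (List.map R xs)
    first-row : P (x ∷ xs) ≡ R x + P xs
    first-row = begin
      sum (List.map (uncurry Q) (List.map (x ,_) xs ++ pairs xs))
        ≡⟨ cong sum (map-++ (uncurry Q) (List.map (x ,_) xs) (pairs xs)) ⟩
      sum (List.map (uncurry Q) (List.map (x ,_) xs) ++ List.map (uncurry Q) (pairs xs))
        ≡⟨ sum-++ (List.map (uncurry Q) (List.map (x ,_) xs)) _ ⟩
      sum (List.map (uncurry Q) (List.map (x ,_) xs)) + P xs
        ≡⟨ cong (λ s → sum s + P xs) (sym (map-∘ xs)) ⟩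
      R x + P xs ∎
    regroup : ∀ q r p d → 2 * (r + p) + (q + d) ≡ q + r + (r + (2 * p + d))
    regroup = solve-∀

-- Sums over the simplex

-- ∑₃ N G sums G a b c over a + b + c ≡ N, i.e. over the points (a , b) of T_(N+1) in
-- barycentric coordinates; ∑₂ m H sums H b c over b + c ≡ m.
∑₂ : ℕ → (ℕ → ℕ → ℕ) → ℕ
∑₂ zero    H = H 0 0
∑₂ (suc m) H = H 0 (suc m) + ∑₂ m (λ b c → H (suc b) c)

∑₃ : ℕ → (ℕ → ℕ → ℕ → ℕ) → ℕ
∑₃ zero    G = G 0 0 0
∑₃ (suc N) G = ∑₂ (suc N) (G 0) + ∑₃ N (λ a → G (suc a))

∑₂-cong : ∀ m {H K} → (∀ b c → b + c ≡ m → H b c ≡ K b c) → ∑₂ m H ≡ ∑₂ m K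
∑₂-cong zero    H≡K = H≡K 0 0 refl
∑₂-cong (suc m) H≡K = cong₂ _+_ (H≡K 0 (suc m) refl) (∑₂-cong m (λ b c e → H≡K (suc b) c (cong suc e)))

∑₃-cong : ∀ N {G K} → (∀ a b c → a + b + c ≡ N → G a b c ≡ K a b c) → ∑₃ N G ≡ ∑₃ N K
∑₃-cong zero    G≡K = G≡K 0 0 0 refl
∑₃-cong (suc N) G≡K = cong₂ _+_ (∑₂-cong (suc N) (λ b c e → G≡K 0 b c e))
                                (∑₃-cong N (λ a b c e → G≡K (suc a) b c (cong suc e)))

∑₂-+ : ∀ m H K → ∑₂ m (λ b c → H b c + K b c) ≡ ∑₂ m H + ∑₂ m K
∑₂-+ zero    H K = refl
∑₂-+ (suc m) H K = trans (cong (H 0 (suc m) + K 0 (suc m) +_) (∑₂-+ m _ _)) (interchange (H 0 (suc m)) _ _ _)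

∑₃-+ : ∀ N G K → ∑₃ N (λ a b c → G a b c + K a b c) ≡ ∑₃ N G + ∑₃ N K
∑₃-+ zero    G K = refl
∑₃-+ (suc N) G K = trans (cong₂ _+_ (∑₂-+ (suc N) (G 0) (K 0)) (∑₃-+ N _ _)) (interchange (∑₂ (suc N) (G 0)) _ _ _)

∑₃-+₃ : ∀ N f g h → ∑₃ N (λ a b c → f a b c + g a b c + h a b c) ≡ ∑₃ N f + ∑₃ N g + ∑₃ N h
∑₃-+₃ N f g h = trans (∑₃-+ N (λ a b c → f a b c + g a b c) h) (cong (_+ ∑₃ N h) (∑₃-+ N f g))

∑₂-*ˡ : ∀ m k H → ∑₂ m (λ b c → k * H b c) ≡ k * ∑₂ m H
∑₂-*ˡ zero    k H = refl
∑₂-*ˡ (suc m) k H = trans (cong (k * H 0 (suc m) +_) (∑₂-*ˡ m k _)) (sym (*-distribˡ-+ k _ _))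

∑₃-*ˡ : ∀ N k G → ∑₃ N (λ a b c → k * G a b c) ≡ k * ∑₃ N G
∑₃-*ˡ zero    k G = refl
∑₃-*ˡ (suc N) k G = trans (cong₂ _+_ (∑₂-*ˡ (suc N) k (G 0)) (∑₃-*ˡ N k _)) (sym (*-distribˡ-+ k _ _))

∑₂-zero : ∀ m → ∑₂ m (λ _ _ → 0) ≡ 0
∑₂-zero zero    = refl
∑₂-zero (suc m) = ∑₂-zero m

∑₃-zero : ∀ N → ∑₃ N (λ _ _ _ → 0) ≡ 0
∑₃-zero zero    = refl
∑₃-zero (suc N) = cong₂ _+_ (∑₂-zero (suc N)) (∑₃-zero N)

tri : ℕ → ℕ
tri zero    = 0
tri (suc n) = suc n + tri n

∑₂-one : ∀ m → ∑₂ m (λ _ _ → 1) ≡ suc m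
∑₂-one zero    = refl
∑₂-one (suc m) = cong suc (∑₂-one m)

∑₃-one : ∀ N → ∑₃ N (λ _ _ _ → 1) ≡ tri (suc N)
∑₃-one zero    = refl
∑₃-one (suc N) = cong₂ _+_ (∑₂-one (suc N)) (∑₃-one N)

∑₂-last : ∀ m H → ∑₂ (suc m) H ≡ ∑₂ m (λ b c → H b (suc c)) + H (suc m) 0
∑₂-last zero    H = refl
∑₂-last (suc m) H = trans (cong (H 0 (2 + m) +_) (∑₂-last m (λ b c → H (suc b) c))) (sym (+-assoc (H 0 (2 + m)) _ _))

∑₂-swap : ∀ m H → ∑₂ m (λ b c → H c b) ≡ ∑₂ m H
∑₂-swap zero    H = refl
∑₂-swap (suc m) H = begin
  H (suc m) 0 + ∑₂ m (λ b c → H c (suc b))   ≡⟨ cong (H (suc m) 0 +_) (∑₂-swap m (λ b c → H b (suc c))) ⟩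
  H (suc m) 0 + ∑₂ m (λ b c → H b (suc c))   ≡⟨ +-comm (H (suc m) 0) _ ⟩
  ∑₂ m (λ b c → H b (suc c)) + H (suc m) 0   ≡⟨ sym (∑₂-last m H) ⟩
  ∑₂ (suc m) H                               ∎
  where open ≡-Reasoning

∑₃-swap₂₃ : ∀ N G → ∑₃ N (λ a b c → G a c b) ≡ ∑₃ N G
∑₃-swap₂₃ zero    G = refl
∑₃-swap₂₃ (suc N) G = cong₂ _+_ (∑₂-swap (suc N) (G 0)) (∑₃-swap₂₃ N (λ a → G (suc a)))

∑₃-peel₂ : ∀ N G → ∑₃ (suc N) G ≡ ∑₂ (suc N) (λ a c → G a 0 c) + ∑₃ N (λ a b c → G a (suc b) c)
∑₃-peel₂ zero    G = xy∙z≈xz∙y (G 0 0 1) (G 0 1 0) (G 1 0 0)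
∑₃-peel₂ (suc N) G =
  trans (cong (∑₂ (2 + N) (G 0) +_) (∑₃-peel₂ N (λ a → G (suc a)))) (interchange (G 0 0 (2 + N)) _ _ _)

∑₃-peel₁₂ : ∀ N G → ∑₃ (2 + N) G ≡
  ∑₂ (2 + N) (G 0) + ∑₂ (suc N) (λ a c → G (suc a) 0 c) + ∑₃ N (λ a b c → G (suc a) (suc b) c)
∑₃-peel₁₂ N G = trans (cong (∑₂ (2 + N) (G 0) +_) (∑₃-peel₂ N (λ a → G (suc a))))
  (sym (+-assoc (∑₂ (2 + N) (G 0)) (∑₂ (suc N) (λ a c → G (suc a) 0 c)) (∑₃ N (λ a b c → G (suc a) (suc b) c))))

∑₃-swap₁₂ : ∀ N G → ∑₃ N (λ a b c → G b a c) ≡ ∑₃ N G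
∑₃-swap₁₂ zero    G = refl
∑₃-swap₁₂ (suc N) G =
  trans (∑₃-peel₂ N (λ a b c → G b a c)) (cong (∑₂ (suc N) (G 0) +_) (∑₃-swap₁₂ N (λ a → G (suc a))))

∑₃-rotate : ∀ N G → ∑₃ N (λ a b c → G b c a) ≡ ∑₃ N G
∑₃-rotate N G = trans (∑₃-swap₁₂ N (λ a b c → G a c b)) (∑₃-swap₂₃ N G)

∑₃-rotate² : ∀ N G → ∑₃ N (λ a b c → G c a b) ≡ ∑₃ N G
∑₃-rotate² N G = trans (∑₃-rotate N (λ a b c → G b c a)) (∑₃-rotate N G)

∑₃-cyclic : ∀ N f → ∑₃ N (λ a b c → f a b c + f b c a + f c a b) ≡ 3 * ∑₃ N f
∑₃-cyclic N f = begin
  ∑₃ N (λ a b c → f a b c + f b c a + f c a b)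
    ≡⟨ ∑₃-+₃ N f _ _ ⟩
  ∑₃ N f + ∑₃ N (λ a b c → f b c a) + ∑₃ N (λ a b c → f c a b)
    ≡⟨ cong₂ (λ s t → ∑₃ N f + s + t) (∑₃-rotate N f) (∑₃-rotate² N f) ⟩
  ∑₃ N f + ∑₃ N f + ∑₃ N f
    ≡⟨ thrice (∑₃ N f) ⟩
  3 * ∑₃ N f ∎
  where
  open ≡-Reasoning
  thrice : ∀ s → s + s + s ≡ 3 * s
  thrice = solve-∀

sum-applyUpTo-∑₂ : ∀ m f → sum (applyUpTo f (suc m)) ≡ ∑₂ m (λ b _ → f b)
sum-applyUpTo-∑₂ zero    f = +-identityʳ (f 0)
sum-applyUpTo-∑₂ (suc m) f = cong (f 0 +_) (sum-applyUpTo-∑₂ m (λ b → f (suc b)))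

sum-applyUpTo-∑₃ : ∀ N (K : ℕ → ℕ → ℕ) →
  sum (applyUpTo (λ a → sum (applyUpTo (K a) (suc N ∸ a))) (suc N)) ≡ ∑₃ N (λ a b _ → K a b)
sum-applyUpTo-∑₃ zero    K = trans (+-identityʳ _) (+-identityʳ (K 0 0))
sum-applyUpTo-∑₃ (suc N) K = cong₂ _+_ (sum-applyUpTo-∑₂ (suc N) (K 0)) (sum-applyUpTo-∑₃ N (λ a → K (suc a)))

sum-points : ∀ N (F : Point → ℕ) → sum (List.map F (points (suc N))) ≡ ∑₃ N (λ a b _ → F (a , b))
sum-points N F = begin
  sum (List.map F (points (suc N)))
    ≡⟨ sum-map-concatMap F row (upTo (suc N)) ⟩
  sum (List.map (λ a → sum (List.map F (row a))) (upTo (suc N)))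
    ≡⟨ cong sum (map-cong (λ a → cong sum (trans (sym (map-∘ (upTo (suc N ∸ a)))) (map-upTo _ (suc N ∸ a)))) (upTo (suc N))) ⟩
  sum (List.map (λ a → sum (applyUpTo (λ b → F (a , b)) (suc N ∸ a))) (upTo (suc N)))
    ≡⟨ cong sum (map-upTo _ (suc N)) ⟩
  sum (applyUpTo (λ a → sum (applyUpTo (λ b → F (a , b)) (suc N ∸ a))) (suc N))
    ≡⟨ sum-applyUpTo-∑₃ N (λ a b → F (a , b)) ⟩
  ∑₃ N (λ a b _ → F (a , b)) ∎
  where
  open ≡-Reasoning
  row : ℕ → List Point
  row a = List.map (λ b → (a , b)) (upTo (suc N ∸ a))

∑₂-point : ∀ m v → ∑₂ m (λ y _ → ⟦ y ≟ v ⟧) ≡ ⟦ v <? suc m ⟧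
∑₂-point zero    zero    = refl
∑₂-point zero    (suc v) = refl
∑₂-point (suc m) zero    = cong suc (∑₂-zero m)
∑₂-point (suc m) (suc v) = ∑₂-point m v

∑₃-point : ∀ N u v → ∑₃ N (λ x y _ → ⟦ x ≟ u ⟧ * ⟦ y ≟ v ⟧) ≡ ⟦ u + v <? suc N ⟧
∑₃-point zero    zero    zero    = refl
∑₃-point zero    zero    (suc v) = refl
∑₃-point zero    (suc u) v       = refl
∑₃-point (suc N) zero    v       = trans
  (cong₂ _+_ (trans (∑₂-cong (suc N) (λ y _ _ → +-identityʳ ⟦ y ≟ v ⟧)) (∑₂-point (suc N) v)) (∑₃-zero N))
  (+-identityʳ ⟦ v <? suc (suc N) ⟧)
∑₃-point (suc N) (suc u) v       =
  trans (cong (_+ ∑₃ N (λ x y _ → ⟦ x ≟ u ⟧ * ⟦ y ≟ v ⟧)) (∑₂-zero (suc N))) (∑₃-point N u v)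

∑₃-point-shifted : ∀ N k m k′ m′ → ∑₃ N (λ x y _ → ⟦ x + k ≟ m ⟧ * ⟦ y + k′ ≟ m′ ⟧)
  ≡ ⟦ k ≤? m ×-dec (k′ ≤? m′ ×-dec (m ∸ k) + (m′ ∸ k′) <? suc N) ⟧
∑₃-point-shifted N k m k′ m′ = by-cases (k ≤? m) (k′ ≤? m′)
  where
  unshift : ∀ {k m} x → k ≤ m → ⟦ x + k ≟ m ⟧ ≡ ⟦ x ≟ m ∸ k ⟧
  unshift {k} {m} x k≤m = ⟦⟧-⇔ (x + k ≟ m) (x ≟ m ∸ k)
    (mk⇔ (λ e → trans (sym (m+n∸n≡m x k)) (cong (_∸ k) e)) (λ e → trans (cong (_+ k) e) (m∸n+n≡m k≤m)))
  unreachable : ∀ {k m} x → k ≰ m → ⟦ x + k ≟ m ⟧ ≡ 0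
  unreachable {k} {m} x k≰m = ⟦⟧-no (x + k ≟ m) (λ e → k≰m (subst (k ≤_) e (m≤n+m k x)))
  by-cases : (d : Dec (k ≤ m)) (d′ : Dec (k′ ≤ m′)) → ∑₃ N (λ x y _ → ⟦ x + k ≟ m ⟧ * ⟦ y + k′ ≟ m′ ⟧)
    ≡ ⟦ d ×-dec (d′ ×-dec (m ∸ k) + (m′ ∸ k′) <? suc N) ⟧
  by-cases (yes k≤m) (yes k′≤m′) =
    trans (∑₃-cong N (λ x y _ _ → cong₂ _*_ (unshift x k≤m) (unshift y k′≤m′))) (∑₃-point N (m ∸ k) (m′ ∸ k′))
  by-cases (yes _)   (no k′≰m′)  = trans
    (∑₃-cong N (λ x y _ _ → trans (cong (⟦ x + k ≟ m ⟧ *_) (unreachable y k′≰m′)) (*-zeroʳ ⟦ x + k ≟ m ⟧)))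
    (∑₃-zero N)
  by-cases (no k≰m)  _           =
    trans (∑₃-cong N (λ x y _ _ → cong (_* ⟦ y + k′ ≟ m′ ⟧) (unreachable x k≰m))) (∑₃-zero N)

∑₃-corner : ∀ N u → ∑₃ N (λ x _ _ → ⟦ u <? x ⟧) ≡ tri (N ∸ u)
∑₃-corner zero    zero    = refl
∑₃-corner zero    (suc u) = refl
∑₃-corner (suc N) zero    = trans (cong (_+ ∑₃ N (λ _ _ _ → 1)) (∑₂-zero (suc N))) (∑₃-one N)
∑₃-corner (suc N) (suc u) = trans (cong (_+ ∑₃ N (λ x _ _ → ⟦ u <? x ⟧)) (∑₂-zero (suc N))) (∑₃-corner N u)

∑₃-corner² : ∀ N u v → ∑₃ N (λ x y _ → ⟦ u <? x ⟧ * ⟦ v <? y ⟧) ≡ tri (N ∸ suc (u + v))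
∑₃-corner² zero    u       v = refl
∑₃-corner² (suc N) zero    v = trans (cong (_+ ∑₃ N (λ _ y _ → 1 * ⟦ v <? y ⟧)) (∑₂-zero (suc N)))
  (trans (∑₃-cong N (λ _ y _ _ → +-identityʳ ⟦ v <? y ⟧))
         (trans (∑₃-swap₁₂ N (λ x _ _ → ⟦ v <? x ⟧)) (∑₃-corner N v)))
∑₃-corner² (suc N) (suc u) v =
  trans (cong (_+ ∑₃ N (λ x y _ → ⟦ u <? x ⟧ * ⟦ v <? y ⟧)) (∑₂-zero (suc N))) (∑₃-corner² N u v)

Triple : Set
Triple = ℕ × ℕ × ℕ

_≤³_ : Triple → Triple → Set
(x , y , z) ≤³ (u , v , w) = x ≤ u × y ≤ v × z ≤ w

_≤³?_ : ∀ s t → Dec (s ≤³ t)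
(x , y , z) ≤³? (u , v , w) = x ≤? u ×-dec y ≤? v ×-dec z ≤? w

_⊓³_ : Triple → Triple → Triple
(u , v , w) ⊓³ (u′ , v′ , w′) = (u ⊓ u′ , v ⊓ v′ , w ⊓ w′)

≤³-⊓³ : ∀ s t t′ → (s ≤³ t × s ≤³ t′) ⇔ s ≤³ (t ⊓³ t′)
≤³-⊓³ (x , y , z) (u , v , w) (u′ , v′ , w′) = mk⇔
  (λ ((x≤u , y≤v , z≤w) , (x≤u′ , y≤v′ , z≤w′)) → ⊓-glb x≤u x≤u′ , ⊓-glb y≤v y≤v′ , ⊓-glb z≤w z≤w′)
  (λ (x≤ , y≤ , z≤) → (≤-trans x≤ (m⊓n≤m u u′) , ≤-trans y≤ (m⊓n≤m v v′) , ≤-trans z≤ (m⊓n≤m w w′))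
                    , (≤-trans x≤ (m⊓n≤n u u′) , ≤-trans y≤ (m⊓n≤n v v′) , ≤-trans z≤ (m⊓n≤n w w′)))

module _ (N u v w : ℕ) where

  ∑₃-corners : ∑₃ N (λ x _ _ → ⟦ u <? x ⟧) + ∑₃ N (λ _ y _ → ⟦ v <? y ⟧) + ∑₃ N (λ _ _ z → ⟦ w <? z ⟧)
             ≡ tri (N ∸ u) + tri (N ∸ v) + tri (N ∸ w)
  ∑₃-corners = cong₂ _+_ (cong₂ _+_ (∑₃-corner N u) (trans (∑₃-rotate N (λ x _ _ → ⟦ v <? x ⟧)) (∑₃-corner N v)))
                         (trans (∑₃-rotate² N (λ x _ _ → ⟦ w <? x ⟧)) (∑₃-corner N w))

  ∑₃-corner-pairs : ∑₃ N (λ _ y z → ⟦ v <? y ⟧ * ⟦ w <? z ⟧) + ∑₃ N (λ x _ z → ⟦ w <? z ⟧ * ⟦ u <? x ⟧)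
                      + ∑₃ N (λ x y _ → ⟦ u <? x ⟧ * ⟦ v <? y ⟧)
                  ≡ tri (N ∸ suc (v + w)) + tri (N ∸ suc (w + u)) + tri (N ∸ suc (u + v))
  ∑₃-corner-pairs = cong₂ _+_
    (cong₂ _+_ (trans (∑₃-rotate N (λ x y _ → ⟦ v <? x ⟧ * ⟦ w <? y ⟧)) (∑₃-corner² N v w))
               (trans (∑₃-rotate² N (λ x y _ → ⟦ w <? x ⟧ * ⟦ u <? y ⟧)) (∑₃-corner² N w u)))
    (∑₃-corner² N u v)

  -- The hypothesis says that no point of the simplex lies in all three corners u < x, v < y, w < z.
  hexagon-pointwise : N ≤ 2 + (u + v + w) → ∀ x y z → x + y + z ≡ N →
    ⟦ (x , y , z) ≤³? (u , v , w) ⟧ + (⟦ u <? x ⟧ + ⟦ v <? y ⟧ + ⟦ w <? z ⟧)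
      ≡ 1 + (⟦ v <? y ⟧ * ⟦ w <? z ⟧ + ⟦ w <? z ⟧ * ⟦ u <? x ⟧ + ⟦ u <? x ⟧ * ⟦ v <? y ⟧)
  hexagon-pointwise N≤2+s x y z refl = trans
    (cong (_+ (⟦ u <? x ⟧ + ⟦ v <? y ⟧ + ⟦ w <? z ⟧))
          (⟦⟧-⇔ ((x , y , z) ≤³? (u , v , w)) (¬? (u <? x) ×-dec ¬? (v <? y) ×-dec ¬? (w <? z)) ≤³⇔≮))
    (inclusion-exclusion₃ (u <? x) (v <? y) (w <? z) three-corners)
    where
    ≤³⇔≮ : (x , y , z) ≤³ (u , v , w) ⇔ (¬ u < x × ¬ v < y × ¬ w < z)
    ≤³⇔≮ = mk⇔ (λ (x≤u , y≤v , z≤w) → ≤⇒≯ x≤u , ≤⇒≯ y≤v , ≤⇒≯ z≤w)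
               (λ (u≮x , v≮y , w≮z) → ≮⇒≥ u≮x , ≮⇒≥ v≮y , ≮⇒≥ w≮z)
    suc-sum : ∀ u v w → suc u + suc v + suc w ≡ 3 + (u + v + w)
    suc-sum = solve-∀
    three-corners : ¬ (u < x × v < y × w < z)
    three-corners (u<x , v<y , w<z) = n≮n (u + v + w) (s≤s⁻¹ (s≤s⁻¹ (≤-trans
      (subst (_≤ x + y + z) (suc-sum u v w) (+-mono-≤ (+-mono-≤ u<x v<y) w<z)) N≤2+s)))

  hexagon : N ≤ 2 + (u + v + w) →
    ∑₃ N (λ x y z → ⟦ (x , y , z) ≤³? (u , v , w) ⟧) + (tri (N ∸ u) + tri (N ∸ v) + tri (N ∸ w))
      ≡ tri (suc N) + (tri (N ∸ suc (v + w)) + tri (N ∸ suc (w + u)) + tri (N ∸ suc (u + v)))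
  hexagon N≤2+s = begin
    ∑₃ N inside + (tri (N ∸ u) + tri (N ∸ v) + tri (N ∸ w))
      ≡⟨ cong (∑₃ N inside +_) (sym (trans (∑₃-+₃ N X Y Z) ∑₃-corners)) ⟩
    ∑₃ N inside + ∑₃ N (λ x y z → X x y z + Y x y z + Z x y z)
      ≡⟨ sym (∑₃-+ N inside _) ⟩
    ∑₃ N (λ x y z → inside x y z + (X x y z + Y x y z + Z x y z))
      ≡⟨ ∑₃-cong N (hexagon-pointwise N≤2+s) ⟩
    ∑₃ N (λ x y z → 1 + (Y x y z * Z x y z + Z x y z * X x y z + X x y z * Y x y z))
      ≡⟨ ∑₃-+ N (λ _ _ _ → 1) _ ⟩
    ∑₃ N (λ _ _ _ → 1) + ∑₃ N (λ x y z → Y x y z * Z x y z + Z x y z * X x y z + X x y z * Y x y z)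
      ≡⟨ cong₂ _+_ (∑₃-one N) (trans (∑₃-+₃ N _ _ _) ∑₃-corner-pairs) ⟩
    tri (suc N) + (tri (N ∸ suc (v + w)) + tri (N ∸ suc (w + u)) + tri (N ∸ suc (u + v))) ∎
    where
    open ≡-Reasoning
    inside X Y Z : ℕ → ℕ → ℕ → ℕ
    inside x y z = ⟦ (x , y , z) ≤³? (u , v , w) ⟧
    X x _ _ = ⟦ u <? x ⟧
    Y _ y _ = ⟦ v <? y ⟧
    Z _ _ z = ⟦ w <? z ⟧

  hexagon-disjoint : N ≤ v + w → N ≤ w + u → N ≤ u + v →
    ∑₃ N (λ x y z → ⟦ (x , y , z) ≤³? (u , v , w) ⟧) + (tri (N ∸ u) + tri (N ∸ v) + tri (N ∸ w)) ≡ tri (suc N)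
  hexagon-disjoint N≤v+w N≤w+u N≤u+v = begin
    ∑₃ N (λ x y z → ⟦ (x , y , z) ≤³? (u , v , w) ⟧) + (tri (N ∸ u) + tri (N ∸ v) + tri (N ∸ w))
      ≡⟨ hexagon (≤-trans N≤u+v (≤-trans (m≤m+n (u + v) w) (m≤n+m (u + v + w) 2))) ⟩
    tri (suc N) + (tri (N ∸ suc (v + w)) + tri (N ∸ suc (w + u)) + tri (N ∸ suc (u + v)))
      ≡⟨ cong (tri (suc N) +_) (cong₂ _+_ (cong₂ _+_ (beyond N≤v+w) (beyond N≤w+u)) (beyond N≤u+v)) ⟩
    tri (suc N) + 0
      ≡⟨ +-identityʳ (tri (suc N)) ⟩
    tri (suc N) ∎
    where
    open ≡-Reasoning
    beyond : ∀ {m} → N ≤ m → tri (N ∸ suc m) ≡ 0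
    beyond N≤m = cong tri (m≤n⇒m∸n≡0 (m≤n⇒m≤1+n N≤m))

-- Equilateral triangles in T_n

Equilateral : Point → Point → Point → Set
Equilateral p q r = dist² p r ≡ dist² p q × dist² q r ≡ dist² p q

equilateral? : ∀ p q r → Dec (Equilateral p q r)
equilateral? p q r = (dist² p r ℤ.≟ dist² p q) ×-dec (dist² q r ℤ.≟ dist² p q)

IsApex : Point → Point → Point → Set
IsApex (a , b) (a′ , b′) (x , y) = x + b′ ≡ a + b × y + a ≡ a′ + b′

isApex? : ∀ p q r → Dec (IsApex p q r)
isApex? (a , b) (a′ , b′) (x , y) = (x + b′ ≟ a + b) ×-dec (y + a ≟ a′ + b′)

private
  +-≡⇔ : ∀ i j k l → i + j ≡ k + l ⇔ ℤ.+ i ℤ.+ ℤ.+ j ≡ ℤ.+ k ℤ.+ ℤ.+ l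
  +-≡⇔ i j k l = mk⇔ (λ e → trans (sym (ℤ.pos-+ i j)) (trans (cong ℤ.+_ e) (ℤ.pos-+ k l)))
                     (λ e → ℤ.+-injective (trans (ℤ.pos-+ i j) (trans e (sym (ℤ.pos-+ k l)))))

  +-pair-injective : ∀ {a b a′ b′} → ℤ.+ a ≡ ℤ.+ a′ × ℤ.+ b ≡ ℤ.+ b′ → (a , b) ≡ (a′ , b′)
  +-pair-injective (a≡a′ , b≡b′) = cong₂ _,_ (ℤ.+-injective a≡a′) (ℤ.+-injective b≡b′)

  isApex⇔Apex : ∀ a b a′ b′ x y →
    IsApex (a , b) (a′ , b′) (x , y) ⇔ Lattice.Apex (ℤ.+ a) (ℤ.+ b) (ℤ.+ a′) (ℤ.+ b′) (ℤ.+ x) (ℤ.+ y)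
  isApex⇔Apex a b a′ b′ x y = mk⇔
    (λ (e₁ , e₂) → Equivalence.to (+-≡⇔ x b′ a b) e₁ , Equivalence.to (+-≡⇔ y a a′ b′) e₂)
    (λ (e₁ , e₂) → Equivalence.from (+-≡⇔ x b′ a b) e₁ , Equivalence.from (+-≡⇔ y a a′ b′) e₂)

dist²-comm : ∀ p q → dist² p q ≡ dist² q p
dist²-comm (a , b) (a′ , b′) = Lattice.norm²-swap (ℤ.+ a) (ℤ.+ b) (ℤ.+ a′) (ℤ.+ b′)

equilateral-comm : ∀ p q r → Equilateral p q r → Equilateral q p r
equilateral-comm p q r (pr≡pq , qr≡pq) = trans qr≡pq (dist²-comm p q) , trans pr≡pq (dist²-comm p q)

apex⇒equilateral : ∀ p q r → IsApex p q r → Equilateral p q r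
apex⇒equilateral (a , b) (a′ , b′) (x , y) apex = Lattice.apex⇒equilateral (ℤ.+ a) (ℤ.+ b) (ℤ.+ a′) (ℤ.+ b′) (ℤ.+ x) (ℤ.+ y)
  (Equivalence.to (isApex⇔Apex a b a′ b′ x y) apex)

equilateral⇔apex : ∀ {p q} r → p ≢ q → Equilateral p q r ⇔ (IsApex p q r ⊎ IsApex q p r)
equilateral⇔apex {a , b} {a′ , b′} (x , y) p≢q = mk⇔ to from
  where
  to : Equilateral (a , b) (a′ , b′) (x , y) → IsApex (a , b) (a′ , b′) (x , y) ⊎ IsApex (a′ , b′) (a , b) (x , y)
  to (pr≡pq , qr≡pq) = Sum.map (Equivalence.from (isApex⇔Apex a b a′ b′ x y)) (Equivalence.from (isApex⇔Apex a′ b′ a b x y))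
    (Lattice.equilateral⇒apex (ℤ.+ a) (ℤ.+ b) (ℤ.+ a′) (ℤ.+ b′) (ℤ.+ x) (ℤ.+ y)
      (λ p≡q → p≢q (+-pair-injective p≡q)) pr≡pq qr≡pq)
  from : IsApex (a , b) (a′ , b′) (x , y) ⊎ IsApex (a′ , b′) (a , b) (x , y) → Equilateral (a , b) (a′ , b′) (x , y)
  from (inj₁ pqr) = apex⇒equilateral (a , b) (a′ , b′) (x , y) pqr
  from (inj₂ qpr) = equilateral-comm (a′ , b′) (a , b) (x , y) (apex⇒equilateral (a′ , b′) (a , b) (x , y) qpr)

apex-disjoint : ∀ {p q} r → p ≢ q → ¬ (IsApex p q r × IsApex q p r)
apex-disjoint {a , b} {a′ , b′} (x , y) p≢q (pqr , qpr) = p≢q (+-pair-injective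
  (Lattice.apex-twice⇒≡ (ℤ.+ a) (ℤ.+ b) (ℤ.+ a′) (ℤ.+ b′) (ℤ.+ x) (ℤ.+ y)
    (Equivalence.to (isApex⇔Apex a b a′ b′ x y) pqr) (Equivalence.to (isApex⇔Apex a′ b′ a b x y) qpr)))

equilateral-degenerate⇔apex : ∀ p r → Equilateral p p r ⇔ IsApex p p r
equilateral-degenerate⇔apex (a , b) (x , y) = mk⇔
  (λ (pr≡pp , _) → Equivalence.from (isApex⇔Apex a b a b x y)
                     (Lattice.degenerate⇒apex (ℤ.+ a) (ℤ.+ b) (ℤ.+ x) (ℤ.+ y) pr≡pp))
  (apex⇒equilateral (a , b) (a , b) (x , y))

apexCount : ℕ → Point → Point → ℕ
apexCount n p q = sum (List.map (λ r → ⟦ isApex? p q r ⟧) (points n))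

thirdCount≡apexCounts : ∀ n {p q} → p ≢ q → thirdCount n (p , q) ≡ apexCount n p q + apexCount n q p
thirdCount≡apexCounts n {p} {q} p≢q = begin
  thirdCount n (p , q)
    ≡⟨ length-filter≡sum (equilateral? p q) (points n) ⟩
  sum (List.map (λ r → ⟦ equilateral? p q r ⟧) (points n))
    ≡⟨ cong sum (map-cong split (points n)) ⟩
  sum (List.map (λ r → ⟦ isApex? p q r ⟧ + ⟦ isApex? q p r ⟧) (points n))
    ≡⟨ sum-map-+ (λ r → ⟦ isApex? p q r ⟧) (λ r → ⟦ isApex? q p r ⟧) (points n) ⟩
  apexCount n p q + apexCount n q p ∎
  where
  open ≡-Reasoning
  split : ∀ r → ⟦ equilateral? p q r ⟧ ≡ ⟦ isApex? p q r ⟧ + ⟦ isApex? q p r ⟧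
  split r = ⟦⟧-⊎ (equilateral? p q r) (isApex? p q r) (isApex? q p r) (equilateral⇔apex r p≢q) (apex-disjoint r p≢q)

thirdCount-degenerate : ∀ n p → thirdCount n (p , p) ≡ apexCount n p p
thirdCount-degenerate n p = trans (length-filter≡sum (equilateral? p p) (points n))
  (cong sum (map-cong (λ r → ⟦⟧-⇔ (equilateral? p p r) (isApex? p p r) (equilateral-degenerate⇔apex p r)) (points n)))

thirdCount-comm : ∀ n p q → thirdCount n (p , q) ≡ thirdCount n (q , p)
thirdCount-comm n p q = trans (length-filter≡sum (equilateral? p q) (points n))
  (trans (cong sum (map-cong (λ r → ⟦⟧-⇔ (equilateral? p q r) (equilateral? q p r)
                                          (mk⇔ (equilateral-comm p q r) (equilateral-comm q p r))) (points n)))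
         (sym (length-filter≡sum (equilateral? q p) (points n))))

-- For p , q in T_(N+1), the apex of p q lies in T_(N+1) iff q ≤³ apexBound p, and the apex of
-- q p does iff q ≤³ apexBound′ p.
apexBound apexBound′ : Triple → Triple
apexBound  (a , b , c) = (a + c , b + a , c + b)
apexBound′ (a , b , c) = (a + b , b + c , c + a)

apex∈T apex∈T′ : Triple → Triple → ℕ
apex∈T  p q = ⟦ q ≤³? apexBound p ⟧
apex∈T′ p q = ⟦ q ≤³? apexBound′ p ⟧

transpose-≤ : ∀ {x u y v} → x + u ≡ y + v → x ≤ y ⇔ v ≤ u
transpose-≤ {x} {u} {y} {v} e = mk⇔
  (λ x≤y → +-cancelˡ-≤ x v u (subst (x + v ≤_) (sym e) (+-monoˡ-≤ v x≤y)))
  (λ v≤u → +-cancelʳ-≤ u x y (subst (_≤ y + u) (sym e) (+-monoʳ-≤ y v≤u)))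

apexCount≡apex∈T : ∀ {N} a b c a′ b′ c′ → a + b + c ≡ N → a′ + b′ + c′ ≡ N →
  apexCount (suc N) (a , b) (a′ , b′) ≡ apex∈T (a , b , c) (a′ , b′ , c′)
apexCount≡apex∈T {N} a b c a′ b′ c′ refl q∈T = begin
  apexCount (suc N) (a , b) (a′ , b′)
    ≡⟨ sum-points N (λ r → ⟦ isApex? (a , b) (a′ , b′) r ⟧) ⟩
  ∑₃ N (λ x y _ → ⟦ isApex? (a , b) (a′ , b′) (x , y) ⟧)
    ≡⟨ ∑₃-cong N (λ x y _ _ → ⟦⟧-× (x + b′ ≟ a + b) (y + a ≟ a′ + b′)) ⟩
  ∑₃ N (λ x y _ → ⟦ x + b′ ≟ a + b ⟧ * ⟦ y + a ≟ a′ + b′ ⟧)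
    ≡⟨ ∑₃-point-shifted N b′ (a + b) a (a′ + b′) ⟩
  ⟦ b′ ≤? a + b ×-dec (a ≤? a′ + b′ ×-dec (a + b ∸ b′) + (a′ + b′ ∸ a) <? suc N) ⟧
    ≡⟨ ⟦⟧-⇔ (b′ ≤? a + b ×-dec (a ≤? a′ + b′ ×-dec (a + b ∸ b′) + (a′ + b′ ∸ a) <? suc N))
            ((a′ , b′ , c′) ≤³? apexBound (a , b , c)) (mk⇔ to from) ⟩
  apex∈T (a , b , c) (a′ , b′ , c′) ∎
  where
  open ≡-Reasoning
  c′-bound : a ≤ a′ + b′ ⇔ c′ ≤ c + b
  c′-bound = transpose-≤ (trans (x∙yz≈xz∙y a c b) (sym q∈T))
  a′-bound : b′ ≤ a + b → a ≤ a′ + b′ → (a + b ∸ b′) + (a′ + b′ ∸ a) < suc (a + b + c) ⇔ a′ ≤ a + c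
  a′-bound b′≤a+b a≤a′+b′ = mk⇔
    (λ sum<n → +-cancelʳ-≤ b a′ (a + c) (subst₂ _≤_ sum≡ (xy∙z≈xz∙y a b c) (s≤s⁻¹ sum<n)))
    (λ a′≤a+c → s≤s (subst₂ _≤_ (sym sum≡) (sym (xy∙z≈xz∙y a b c)) (+-monoˡ-≤ b a′≤a+c)))
    where
    regroup : ∀ a b a′ b′ → (a + b) + (a′ + b′) ≡ (a′ + b) + (b′ + a)
    regroup = solve-∀
    sum≡ : (a + b ∸ b′) + (a′ + b′ ∸ a) ≡ a′ + b
    sum≡ = +-cancelʳ-≡ (b′ + a) _ _ (begin
      (a + b ∸ b′) + (a′ + b′ ∸ a) + (b′ + a) ≡⟨ interchange (a + b ∸ b′) _ b′ a ⟩
      (a + b ∸ b′ + b′) + (a′ + b′ ∸ a + a)   ≡⟨ cong₂ _+_ (m∸n+n≡m b′≤a+b) (m∸n+n≡m a≤a′+b′) ⟩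
      (a + b) + (a′ + b′)                     ≡⟨ regroup a b a′ b′ ⟩
      (a′ + b) + (b′ + a)                     ∎)
  to : b′ ≤ a + b × a ≤ a′ + b′ × (a + b ∸ b′) + (a′ + b′ ∸ a) < suc (a + b + c) →
       (a′ , b′ , c′) ≤³ apexBound (a , b , c)
  to (b′≤a+b , a≤a′+b′ , sum<n) = Equivalence.to (a′-bound b′≤a+b a≤a′+b′) sum<n ,
                                   subst (b′ ≤_) (+-comm a b) b′≤a+b , Equivalence.to c′-bound a≤a′+b′
  from : (a′ , b′ , c′) ≤³ apexBound (a , b , c) →
         b′ ≤ a + b × a ≤ a′ + b′ × (a + b ∸ b′) + (a′ + b′ ∸ a) < suc (a + b + c)
  from (a′≤a+c , b′≤b+a , c′≤c+b) = b′≤a+b , a≤a′+b′ , Equivalence.from (a′-bound b′≤a+b a≤a′+b′) a′≤a+c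
    where
    b′≤a+b : b′ ≤ a + b
    b′≤a+b = subst (b′ ≤_) (+-comm b a) b′≤b+a
    a≤a′+b′ : a ≤ a′ + b′
    a≤a′+b′ = Equivalence.from c′-bound c′≤c+b

apexBound-transpose : ∀ {a b c a′ b′ c′} → a + b + c ≡ a′ + b′ + c′ →
  (a , b , c) ≤³ apexBound (a′ , b′ , c′) ⇔ (a′ , b′ , c′) ≤³ apexBound′ (a , b , c)
apexBound-transpose {a} {b} {c} {a′} {b′} {c′} p~q = mk⇔
  (λ (a≤ , b≤ , c≤) → Equivalence.to a′-bound c≤ , Equivalence.to b′-bound a≤ , Equivalence.to c′-bound b≤)
  (λ (a′≤ , b′≤ , c′≤) →
     Equivalence.from b′-bound b′≤ , Equivalence.from c′-bound c′≤ , Equivalence.from a′-bound a′≤)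
  where
  a′-bound : c ≤ c′ + b′ ⇔ a′ ≤ a + b
  a′-bound = transpose-≤ (trans (+-comm c (a + b)) (trans p~q (xy∙z≈zy∙x a′ b′ c′)))
  b′-bound : a ≤ a′ + c′ ⇔ b′ ≤ b + c
  b′-bound = transpose-≤ (trans (sym (+-assoc a b c)) (trans p~q (xy∙z≈xz∙y a′ b′ c′)))
  c′-bound : b ≤ b′ + a′ ⇔ c′ ≤ c + a
  c′-bound = transpose-≤ (trans (x∙yz≈zx∙y b c a) (trans p~q (cong (_+ c′) (+-comm a′ b′))))

thirdCount-diagonal : ∀ {N} a b c → a + b + c ≡ N → thirdCount (suc N) ((a , b) , (a , b)) ≡ 1
thirdCount-diagonal {N} a b c p∈T = trans (thirdCount-degenerate (suc N) (a , b))
  (trans (apexCount≡apex∈T a b c a b c p∈T p∈T)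
         (⟦⟧-yes ((a , b , c) ≤³? apexBound (a , b , c)) (m≤m+n a c , m≤m+n b a , m≤m+n c b)))

thirdCount≡apex∈T : ∀ {N} a b c a′ b′ c′ → a + b + c ≡ N → a′ + b′ + c′ ≡ N → (a , b) ≢ (a′ , b′) →
  thirdCount (suc N) ((a , b) , (a′ , b′)) ≡ apex∈T (a , b , c) (a′ , b′ , c′) + apex∈T′ (a , b , c) (a′ , b′ , c′)
thirdCount≡apex∈T {N} a b c a′ b′ c′ p∈T q∈T p≢q = trans (thirdCount≡apexCounts (suc N) p≢q)
  (cong₂ _+_ (apexCount≡apex∈T a b c a′ b′ c′ p∈T q∈T)
             (trans (apexCount≡apex∈T a′ b′ c′ a b c q∈T p∈T)
                    (⟦⟧-⇔ ((a , b , c) ≤³? apexBound (a′ , b′ , c′)) ((a′ , b′ , c′) ≤³? apexBound′ (a , b , c))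
                          (apexBound-transpose (trans p∈T (sym q∈T))))))

χ₁ : ℕ → Point → Point → ℕ
χ₁ n p q = ⟦ thirdCount n (p , q) ≟ 1 ⟧

χ₁-diagonal : ∀ {N} a b c c′ → a + b + c ≡ N → a + b + c′ ≡ N →
  χ₁ (suc N) (a , b) (a , b) + 2 * (apex∈T (a , b , c) (a , b , c′) * apex∈T′ (a , b , c) (a , b , c′))
    ≡ apex∈T (a , b , c) (a , b , c′) + apex∈T′ (a , b , c) (a , b , c′) + 1
χ₁-diagonal {N} a b c c′ p∈T q∈T = begin
  χ₁ (suc N) (a , b) (a , b) + 2 * (G * G′)
    ≡⟨ cong₂ (λ k g → ⟦ k ≟ 1 ⟧ + 2 * g) (thirdCount-diagonal a b c p∈T) (cong₂ _*_ G≡1 G′≡1) ⟩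
  3
    ≡⟨ cong₂ (λ g g′ → g + g′ + 1) (sym G≡1) (sym G′≡1) ⟩
  G + G′ + 1 ∎
  where
  open ≡-Reasoning
  G G′ : ℕ
  G  = apex∈T (a , b , c) (a , b , c′)
  G′ = apex∈T′ (a , b , c) (a , b , c′)
  c′≡c : c′ ≡ c
  c′≡c = +-cancelˡ-≡ (a + b) c′ c (trans q∈T (sym p∈T))
  G≡1 : G ≡ 1
  G≡1 = ⟦⟧-yes ((a , b , c′) ≤³? apexBound (a , b , c))
    (m≤m+n a c , m≤m+n b a , subst (_≤ c + b) (sym c′≡c) (m≤m+n c b))
  G′≡1 : G′ ≡ 1
  G′≡1 = ⟦⟧-yes ((a , b , c′) ≤³? apexBound′ (a , b , c))
    (m≤m+n a b , m≤m+n b c , subst (_≤ c + a) (sym c′≡c) (m≤m+n c a))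

χ₁-off-diagonal : ∀ {N} a b c a′ b′ c′ → a + b + c ≡ N → a′ + b′ + c′ ≡ N → (a , b) ≢ (a′ , b′) →
  χ₁ (suc N) (a , b) (a′ , b′) + 2 * (apex∈T (a , b , c) (a′ , b′ , c′) * apex∈T′ (a , b , c) (a′ , b′ , c′))
    ≡ apex∈T (a , b , c) (a′ , b′ , c′) + apex∈T′ (a , b , c) (a′ , b′ , c′) + 0
χ₁-off-diagonal a b c a′ b′ c′ p∈T q∈T p≢q = trans
  (cong (λ k → ⟦ k ≟ 1 ⟧ + 2 * (apex∈T (a , b , c) (a′ , b′ , c′) * apex∈T′ (a , b , c) (a′ , b′ , c′)))
        (thirdCount≡apex∈T a b c a′ b′ c′ p∈T q∈T p≢q))
  (trans (⟦⟧-exactly-one ((a′ , b′ , c′) ≤³? apexBound (a , b , c)) ((a′ , b′ , c′) ≤³? apexBound′ (a , b , c)))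
         (sym (+-identityʳ _)))

χ₁-by-apexes : ∀ {N} a b c a′ b′ c′ → a + b + c ≡ N → a′ + b′ + c′ ≡ N →
  (a′≟a : Dec (a′ ≡ a)) (b′≟b : Dec (b′ ≡ b)) →
  χ₁ (suc N) (a , b) (a′ , b′) + 2 * (apex∈T (a , b , c) (a′ , b′ , c′) * apex∈T′ (a , b , c) (a′ , b′ , c′))
    ≡ apex∈T (a , b , c) (a′ , b′ , c′) + apex∈T′ (a , b , c) (a′ , b′ , c′) + ⟦ a′≟a ⟧ * ⟦ b′≟b ⟧
χ₁-by-apexes a b c .a .b c′ p∈T q∈T (yes refl) (yes refl) = χ₁-diagonal a b c c′ p∈T q∈T
χ₁-by-apexes a b c a′ b′ c′ p∈T q∈T (yes _) (no b′≢b) =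
  χ₁-off-diagonal a b c a′ b′ c′ p∈T q∈T (λ p≡q → b′≢b (sym (cong proj₂ p≡q)))
χ₁-by-apexes a b c a′ b′ c′ p∈T q∈T (no a′≢a) _ =
  χ₁-off-diagonal a b c a′ b′ c′ p∈T q∈T (λ p≡q → a′≢a (sym (cong proj₁ p≡q)))

tri-⊔-⊓ : ∀ m n → tri (m ⊔ n) + tri (m ⊓ n) ≡ tri m + tri n
tri-⊔-⊓ m n with ≤-total m n
... | inj₁ m≤n = trans (cong₂ _+_ (cong tri (m≤n⇒m⊔n≡n m≤n)) (cong tri (m≤n⇒m⊓n≡m m≤n))) (+-comm (tri n) (tri m))
... | inj₂ n≤m = cong₂ _+_ (cong tri (m≥n⇒m⊔n≡m n≤m)) (cong tri (m≥n⇒m⊓n≡n n≤m))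

module _ {N : ℕ} (x y z : ℕ) (x+y+z≡N : x + y + z ≡ N) where

  private
    complement : ∀ {m k} → m + k ≡ N → N ∸ m ≡ k
    complement {m} {k} refl = m+n∸m≡n m k

  N∸[x+z]≡y : N ∸ (x + z) ≡ y
  N∸[x+z]≡y = complement (trans (sym (xy∙z≈xz∙y x y z)) x+y+z≡N)

  N∸[x+y]≡z : N ∸ (x + y) ≡ z
  N∸[x+y]≡z = complement x+y+z≡N

  N≤[y+x]+[z+y] : N ≤ (y + x) + (z + y)
  N≤[y+x]+[z+y] = subst (_≤ (y + x) + (z + y)) x+y+z≡N (+-mono-≤ (≤-reflexive (+-comm x y)) (m≤m+n z y))

  N≤[y+z]+[z+x] : N ≤ (y + z) + (z + x)
  N≤[y+z]+[z+x] = subst (_≤ (y + z) + (z + x)) (trans (sym (xy∙z≈yz∙x x y z)) x+y+z≡N) (+-monoʳ-≤ (y + z) (m≤n+m x z))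

  N∸[x+z]⊓[x+y]≡y⊔z : N ∸ ((x + z) ⊓ (x + y)) ≡ y ⊔ z
  N∸[x+z]⊓[x+y]≡y⊔z = begin
    N ∸ ((x + z) ⊓ (x + y))       ≡⟨ cong₂ _∸_ (trans (sym x+y+z≡N) (sym (x∙yz≈xz∙y x z y))) (sym (+-distribˡ-⊓ x z y)) ⟩
    (x + (z + y)) ∸ (x + (z ⊓ y)) ≡⟨ [m+n]∸[m+o]≡n∸o x (z + y) (z ⊓ y) ⟩
    (z + y) ∸ (z ⊓ y)             ≡⟨ +∸⊓ z y ⟩
    y ⊔ z                         ∎
    where
    open ≡-Reasoning
    +∸⊓ : ∀ m n → (m + n) ∸ (m ⊓ n) ≡ n ⊔ m
    +∸⊓ m n with ≤-total m n
    ... | inj₁ m≤n = trans (cong ((m + n) ∸_) (m≤n⇒m⊓n≡m m≤n)) (trans (m+n∸m≡n m n) (sym (m≥n⇒m⊔n≡m m≤n)))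
    ... | inj₂ n≤m = trans (cong ((m + n) ∸_) (m≥n⇒m⊓n≡n n≤m)) (trans (m+n∸n≡m m n) (sym (m≤n⇒m⊔n≡n n≤m)))

  N∸suc[meets]≡x∸suc[y+z] : N ∸ suc (((y + x) ⊓ (y + z)) + ((z + y) ⊓ (z + x))) ≡ x ∸ suc (y + z)
  N∸suc[meets]≡x∸suc[y+z] = begin
    N ∸ suc (((y + x) ⊓ (y + z)) + ((z + y) ⊓ (z + x)))
      ≡⟨ cong (λ s → N ∸ suc s) (sym (cong₂ _+_ (+-distribˡ-⊓ y x z) (+-distribˡ-⊓ z y x))) ⟩
    N ∸ suc ((y + (x ⊓ z)) + (z + (y ⊓ x)))
      ≡⟨ cong₂ (λ n s → n ∸ suc s) (trans (sym x+y+z≡N) (xy∙z≈yz∙x x y z)) (interchange y (x ⊓ z) z (y ⊓ x)) ⟩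
    ((y + z) + x) ∸ suc ((y + z) + ((x ⊓ z) + (y ⊓ x)))
      ≡⟨ cong (((y + z) + x) ∸_) (sym (+-suc (y + z) _)) ⟩
    ((y + z) + x) ∸ ((y + z) + suc ((x ⊓ z) + (y ⊓ x)))
      ≡⟨ [m+n]∸[m+o]≡n∸o (y + z) x _ ⟩
    x ∸ suc ((x ⊓ z) + (y ⊓ x))
      ≡⟨ excess (≤-total x z) (≤-total x y) ⟩
    x ∸ suc (y + z) ∎
    where
    open ≡-Reasoning
    vanish : ∀ {k} → x ≤ k → x ∸ suc k ≡ 0
    vanish x≤k = m≤n⇒m∸n≡0 (m≤n⇒m≤1+n x≤k)
    excess : x ≤ z ⊎ z ≤ x → x ≤ y ⊎ y ≤ x → x ∸ suc ((x ⊓ z) + (y ⊓ x)) ≡ x ∸ suc (y + z)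
    excess (inj₁ x≤z) _ = trans (cong (λ k → x ∸ suc (k + (y ⊓ x))) (m≤n⇒m⊓n≡m x≤z))
      (trans (vanish (m≤m+n x (y ⊓ x))) (sym (vanish (≤-trans x≤z (m≤n+m z y)))))
    excess (inj₂ _) (inj₁ x≤y) = trans (cong (λ k → x ∸ suc ((x ⊓ z) + k)) (m≥n⇒m⊓n≡n x≤y))
      (trans (vanish (m≤n+m x (x ⊓ z))) (sym (vanish (≤-trans x≤y (m≤m+n y z)))))
    excess (inj₂ z≤x) (inj₂ y≤x) =
      trans (cong₂ (λ k l → x ∸ suc (k + l)) (m≥n⇒m⊓n≡n z≤x) (m≤n⇒m⊓n≡m y≤x)) (cong (λ s → x ∸ suc s) (+-comm z y))

row-algebra : ∀ χ h g g′ S X Y Mn ta tb tc →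
  χ + 2 * h ≡ g + g′ + 1 → g + (tb + tc + ta) ≡ S → g′ + (tc + ta + tb) ≡ S →
  h + X ≡ S + Y → X + Mn ≡ (tb + tc) + (tc + ta) + (ta + tb) →
  χ + 2 * (Y + Mn) ≡ 2 * (ta + tb + tc) + 1
row-algebra χ h g g′ S X Y Mn ta tb tc χ+2h g+A g′+A h+X X+Mn = +-cancelʳ-≡ (2 * S) _ _ (begin
  χ + 2 * (Y + Mn) + 2 * S                                ≡⟨ step₁ χ Y Mn S ⟩
  χ + 2 * Mn + 2 * (S + Y)                                ≡⟨ cong (λ t → χ + 2 * Mn + 2 * t) (sym h+X) ⟩
  χ + 2 * Mn + 2 * (h + X)                                ≡⟨ step₂ χ Mn h X ⟩
  (χ + 2 * h) + 2 * (X + Mn)                              ≡⟨ cong₂ (λ s t → s + 2 * t) χ+2h X+Mn ⟩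
  (g + g′ + 1) + 2 * ((tb + tc) + (tc + ta) + (ta + tb))  ≡⟨ step₃ g g′ ta tb tc ⟩
  (g + (tb + tc + ta)) + (g′ + (tc + ta + tb)) + (2 * (ta + tb + tc) + 1)
                                                          ≡⟨ cong₂ (λ s t → s + t + (2 * (ta + tb + tc) + 1)) g+A g′+A ⟩
  S + S + (2 * (ta + tb + tc) + 1)                        ≡⟨ step₄ S (2 * (ta + tb + tc) + 1) ⟩
  2 * (ta + tb + tc) + 1 + 2 * S                          ∎)
  where
  open ≡-Reasoning
  step₁ : ∀ χ Y Mn S → χ + 2 * (Y + Mn) + 2 * S ≡ χ + 2 * Mn + 2 * (S + Y)
  step₁ = solve-∀
  step₂ : ∀ χ Mn h X → χ + 2 * Mn + 2 * (h + X) ≡ (χ + 2 * h) + 2 * (X + Mn)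
  step₂ = solve-∀
  step₃ : ∀ g g′ ta tb tc → (g + g′ + 1) + 2 * ((tb + tc) + (tc + ta) + (ta + tb))
                          ≡ (g + (tb + tc + ta)) + (g′ + (tc + ta + tb)) + (2 * (ta + tb + tc) + 1)
  step₃ = solve-∀
  step₄ : ∀ S r → S + S + r ≡ r + 2 * S
  step₄ = solve-∀

module _ {N : ℕ} (a b c : ℕ) (p∈T : a + b + c ≡ N) where

  private
    p∈T₁ : b + c + a ≡ N
    p∈T₁ = trans (trans (+-comm (b + c) a) (sym (+-assoc a b c))) p∈T
    p∈T₂ : c + a + b ≡ N
    p∈T₂ = trans (trans (+-comm (c + a) b) (sym (+-assoc b c a))) p∈T₁
    G G′ : ℕ → ℕ → ℕ → ℕ
    G  a′ b′ c′ = apex∈T  (a , b , c) (a′ , b′ , c′)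
    G′ a′ b′ c′ = apex∈T′ (a , b , c) (a′ , b′ , c′)

  row-χ₁ : ∑₃ N (λ a′ b′ _ → χ₁ (suc N) (a , b) (a′ , b′))
             + 2 * ∑₃ N (λ a′ b′ c′ → G a′ b′ c′ * G′ a′ b′ c′)
         ≡ ∑₃ N G + ∑₃ N G′ + 1
  row-χ₁ = begin
    ∑₃ N χ + 2 * ∑₃ N (λ a′ b′ c′ → G a′ b′ c′ * G′ a′ b′ c′)
      ≡⟨ cong (∑₃ N χ +_) (sym (∑₃-*ˡ N 2 _)) ⟩
    ∑₃ N χ + ∑₃ N (λ a′ b′ c′ → 2 * (G a′ b′ c′ * G′ a′ b′ c′))
      ≡⟨ sym (∑₃-+ N χ _) ⟩
    ∑₃ N (λ a′ b′ c′ → χ a′ b′ c′ + 2 * (G a′ b′ c′ * G′ a′ b′ c′))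
      ≡⟨ ∑₃-cong N (λ a′ b′ c′ q∈T → χ₁-by-apexes a b c a′ b′ c′ p∈T q∈T (a′ ≟ a) (b′ ≟ b)) ⟩
    ∑₃ N (λ a′ b′ c′ → G a′ b′ c′ + G′ a′ b′ c′ + ⟦ a′ ≟ a ⟧ * ⟦ b′ ≟ b ⟧)
      ≡⟨ ∑₃-+₃ N G G′ _ ⟩
    ∑₃ N G + ∑₃ N G′ + ∑₃ N (λ a′ b′ _ → ⟦ a′ ≟ a ⟧ * ⟦ b′ ≟ b ⟧)
      ≡⟨ cong (∑₃ N G + ∑₃ N G′ +_) (trans (∑₃-point N a b) (⟦⟧-yes (a + b <? suc N) a+b<suc[N])) ⟩
    ∑₃ N G + ∑₃ N G′ + 1 ∎
    where
    open ≡-Reasoning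
    χ : ℕ → ℕ → ℕ → ℕ
    χ a′ b′ _ = χ₁ (suc N) (a , b) (a′ , b′)
    a+b<suc[N] : a + b < suc N
    a+b<suc[N] = s≤s (subst (a + b ≤_) p∈T (m≤m+n (a + b) c))

  row-apex : ∑₃ N G + (tri b + tri c + tri a) ≡ tri (suc N)
  row-apex = trans
    (cong (∑₃ N G +_) (sym (cong₂ _+_ (cong₂ _+_ (cong tri (N∸[x+z]≡y a b c p∈T)) (cong tri (N∸[x+z]≡y b c a p∈T₁)))
                                      (cong tri (N∸[x+z]≡y c a b p∈T₂)))))
    (hexagon-disjoint N (a + c) (b + a) (c + b)
      (N≤[y+x]+[z+y] a b c p∈T) (N≤[y+x]+[z+y] b c a p∈T₁) (N≤[y+x]+[z+y] c a b p∈T₂))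

  row-apex′ : ∑₃ N G′ + (tri c + tri a + tri b) ≡ tri (suc N)
  row-apex′ = trans
    (cong (∑₃ N G′ +_) (sym (cong₂ _+_ (cong₂ _+_ (cong tri (N∸[x+y]≡z a b c p∈T)) (cong tri (N∸[x+y]≡z b c a p∈T₁)))
                                       (cong tri (N∸[x+y]≡z c a b p∈T₂)))))
    (hexagon-disjoint N (a + b) (b + c) (c + a)
      (N≤[y+z]+[z+x] a b c p∈T) (N≤[y+z]+[z+x] b c a p∈T₁) (N≤[y+z]+[z+x] c a b p∈T₂))

  row-apex-both : ∑₃ N (λ a′ b′ c′ → G a′ b′ c′ * G′ a′ b′ c′) + (tri (b ⊔ c) + tri (c ⊔ a) + tri (a ⊔ b))
                ≡ tri (suc N) + (tri (a ∸ suc (b + c)) + tri (b ∸ suc (c + a)) + tri (c ∸ suc (a + b)))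
  row-apex-both = begin
    ∑₃ N (λ a′ b′ c′ → G a′ b′ c′ * G′ a′ b′ c′) + (tri (b ⊔ c) + tri (c ⊔ a) + tri (a ⊔ b))
      ≡⟨ cong₂ _+_ (∑₃-cong N (λ a′ b′ c′ _ → meet a′ b′ c′))
           (sym (cong₂ _+_ (cong₂ _+_ (cong tri (N∸[x+z]⊓[x+y]≡y⊔z a b c p∈T)) (cong tri (N∸[x+z]⊓[x+y]≡y⊔z b c a p∈T₁)))
                           (cong tri (N∸[x+z]⊓[x+y]≡y⊔z c a b p∈T₂)))) ⟩
    ∑₃ N (λ x y z → ⟦ (x , y , z) ≤³? (U , V , W) ⟧) + (tri (N ∸ U) + tri (N ∸ V) + tri (N ∸ W))
      ≡⟨ hexagon N U V W (≤-trans N≤U+V+W (m≤n+m (U + V + W) 2)) ⟩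
    tri (suc N) + (tri (N ∸ suc (V + W)) + tri (N ∸ suc (W + U)) + tri (N ∸ suc (U + V)))
      ≡⟨ cong (tri (suc N) +_) (cong₂ _+_
           (cong₂ _+_ (cong tri (N∸suc[meets]≡x∸suc[y+z] a b c p∈T)) (cong tri (N∸suc[meets]≡x∸suc[y+z] b c a p∈T₁)))
           (cong tri (N∸suc[meets]≡x∸suc[y+z] c a b p∈T₂))) ⟩
    tri (suc N) + (tri (a ∸ suc (b + c)) + tri (b ∸ suc (c + a)) + tri (c ∸ suc (a + b))) ∎
    where
    open ≡-Reasoning
    U V W : ℕ
    U = (a + c) ⊓ (a + b)
    V = (b + a) ⊓ (b + c)
    W = (c + b) ⊓ (c + a)
    meet : ∀ a′ b′ c′ → G a′ b′ c′ * G′ a′ b′ c′ ≡ ⟦ (a′ , b′ , c′) ≤³? (U , V , W) ⟧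
    meet a′ b′ c′ = trans
      (sym (⟦⟧-× ((a′ , b′ , c′) ≤³? apexBound (a , b , c)) ((a′ , b′ , c′) ≤³? apexBound′ (a , b , c))))
      (⟦⟧-⇔ ((a′ , b′ , c′) ≤³? apexBound (a , b , c) ×-dec (a′ , b′ , c′) ≤³? apexBound′ (a , b , c))
            ((a′ , b′ , c′) ≤³? (U , V , W)) (≤³-⊓³ (a′ , b′ , c′) (apexBound (a , b , c)) (apexBound′ (a , b , c))))
    N≤U+V+W : N ≤ U + V + W
    N≤U+V+W = subst (_≤ U + V + W) p∈T
      (+-mono-≤ (+-mono-≤ (⊓-glb (m≤m+n a c) (m≤m+n a b)) (⊓-glb (m≤m+n b a) (m≤m+n b c))) (⊓-glb (m≤m+n c b) (m≤m+n c a)))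

  tri-maxima+minima : tri (b ⊔ c) + tri (c ⊔ a) + tri (a ⊔ b) + (tri (b ⊓ c) + tri (c ⊓ a) + tri (a ⊓ b))
                    ≡ (tri b + tri c) + (tri c + tri a) + (tri a + tri b)
  tri-maxima+minima = trans (regroup (tri (b ⊔ c)) (tri (c ⊔ a)) (tri (a ⊔ b)) (tri (b ⊓ c)) (tri (c ⊓ a)) (tri (a ⊓ b)))
                            (cong₂ _+_ (cong₂ _+_ (tri-⊔-⊓ b c) (tri-⊔-⊓ c a)) (tri-⊔-⊓ a b))
    where
    regroup : ∀ x₁ x₂ x₃ m₁ m₂ m₃ → x₁ + x₂ + x₃ + (m₁ + m₂ + m₃) ≡ (x₁ + m₁) + (x₂ + m₂) + (x₃ + m₃)
    regroup = solve-∀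

  row-identity : ∑₃ N (λ a′ b′ _ → χ₁ (suc N) (a , b) (a′ , b′))
                   + 2 * ((tri (a ∸ suc (b + c)) + tri (b ∸ suc (c + a)) + tri (c ∸ suc (a + b)))
                          + (tri (b ⊓ c) + tri (c ⊓ a) + tri (a ⊓ b)))
               ≡ 2 * (tri a + tri b + tri c) + 1
  row-identity = row-algebra
    (∑₃ N (λ a′ b′ _ → χ₁ (suc N) (a , b) (a′ , b′))) (∑₃ N (λ a′ b′ c′ → G a′ b′ c′ * G′ a′ b′ c′))
    (∑₃ N G) (∑₃ N G′) (tri (suc N)) (tri (b ⊔ c) + tri (c ⊔ a) + tri (a ⊔ b))
    (tri (a ∸ suc (b + c)) + tri (b ∸ suc (c + a)) + tri (c ∸ suc (a + b))) (tri (b ⊓ c) + tri (c ⊓ a) + tri (a ⊓ b))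
    (tri a) (tri b) (tri c)
    row-χ₁ row-apex row-apex′ row-apex-both tri-maxima+minima

a₁-double-sum : ∀ N →
  2 * a 1 (suc N) + tri (suc N) ≡ ∑₃ N (λ a b _ → ∑₃ N (λ a′ b′ _ → χ₁ (suc N) (a , b) (a′ , b′)))
a₁-double-sum N = begin
  2 * a 1 (suc N) + tri (suc N)
    ≡⟨ cong₂ (λ s t → 2 * s + t) (length-filter≡sum (λ pq → thirdCount (suc N) pq ≟ 1) (pairs T)) (sym diagonal) ⟩
  2 * sum (List.map (uncurry (χ₁ (suc N))) (pairs T)) + sum (List.map (λ p → χ₁ (suc N) p p) T)
    ≡⟨ sum-pairs (χ₁ (suc N)) (λ p q → cong (λ k → ⟦ k ≟ 1 ⟧) (thirdCount-comm (suc N) p q)) T ⟩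
  sum (List.map (λ p → sum (List.map (χ₁ (suc N) p) T)) T)
    ≡⟨ sum-points N (λ p → sum (List.map (χ₁ (suc N) p) T)) ⟩
  ∑₃ N (λ a b _ → sum (List.map (χ₁ (suc N) (a , b)) T))
    ≡⟨ ∑₃-cong N (λ a b _ _ → sum-points N (χ₁ (suc N) (a , b))) ⟩
  ∑₃ N (λ a b _ → ∑₃ N (λ a′ b′ _ → χ₁ (suc N) (a , b) (a′ , b′))) ∎
  where
  open ≡-Reasoning
  T : List Point
  T = points (suc N)
  diagonal : sum (List.map (λ p → χ₁ (suc N) p p) T) ≡ tri (suc N)
  diagonal = trans (sum-points N (λ p → χ₁ (suc N) p p))
    (trans (∑₃-cong N (λ a b c p∈T → cong (λ k → ⟦ k ≟ 1 ⟧) (thirdCount-diagonal a b c p∈T))) (∑₃-one N))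

T₁ Tₘ Tₓ : ℕ → ℕ
T₁ N = ∑₃ N (λ a _ _ → tri a)
Tₘ N = ∑₃ N (λ a b _ → tri (a ⊓ b))
Tₓ N = ∑₃ N (λ a b c → tri (a ∸ suc (b + c)))

rows-summed : ∀ N → ∑₃ N (λ a b _ → ∑₃ N (λ a′ b′ _ → χ₁ (suc N) (a , b) (a′ , b′))) + 2 * (3 * Tₓ N + 3 * Tₘ N)
                  ≡ 2 * (3 * T₁ N) + tri (suc N)
rows-summed N = begin
  ∑₃ N row + 2 * (3 * Tₓ N + 3 * Tₘ N)
    ≡⟨ cong (λ t → ∑₃ N row + 2 * t) (cong₂ _+_ (sym (∑₃-cyclic N excess))
         (sym (trans (∑₃-cyclic N min₂₃) (cong (3 *_) (∑₃-rotate N (λ a b _ → tri (a ⊓ b))))))) ⟩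
  ∑₃ N row + 2 * (∑₃ N excesses + ∑₃ N minima)
    ≡⟨ cong (∑₃ N row +_) (trans (cong (2 *_) (sym (∑₃-+ N excesses minima))) (sym (∑₃-*ˡ N 2 _))) ⟩
  ∑₃ N row + ∑₃ N (λ a b c → 2 * (excesses a b c + minima a b c))
    ≡⟨ sym (∑₃-+ N row _) ⟩
  ∑₃ N (λ a b c → row a b c + 2 * (excesses a b c + minima a b c))
    ≡⟨ ∑₃-cong N row-identity ⟩
  ∑₃ N (λ a b c → 2 * (tri a + tri b + tri c) + 1)
    ≡⟨ ∑₃-+ N _ (λ _ _ _ → 1) ⟩
  ∑₃ N (λ a b c → 2 * (tri a + tri b + tri c)) + ∑₃ N (λ _ _ _ → 1)
    ≡⟨ cong₂ _+_ (trans (∑₃-*ˡ N 2 _) (cong (2 *_) (∑₃-cyclic N (λ a _ _ → tri a)))) (∑₃-one N) ⟩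
  2 * (3 * T₁ N) + tri (suc N) ∎
  where
  open ≡-Reasoning
  row excess min₂₃ excesses minima : ℕ → ℕ → ℕ → ℕ
  row a b _ = ∑₃ N (λ a′ b′ _ → χ₁ (suc N) (a , b) (a′ , b′))
  excess a b c = tri (a ∸ suc (b + c))
  min₂₃ _ b c = tri (b ⊓ c)
  excesses a b c = excess a b c + excess b c a + excess c a b
  minima a b c = min₂₃ a b c + min₂₃ b c a + min₂₃ c a b

a₁-by-triangle-sums : ∀ N → a 1 (suc N) + 3 * (Tₓ N + Tₘ N) ≡ 3 * T₁ N
a₁-by-triangle-sums N = *-cancelˡ-≡ _ _ 2 (+-cancelʳ-≡ (tri (suc N)) _ _ (begin
  2 * (a 1 (suc N) + 3 * (Tₓ N + Tₘ N)) + tri (suc N)           ≡⟨ regroup (a 1 (suc N)) (Tₓ N) (Tₘ N) (tri (suc N)) ⟩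
  (2 * a 1 (suc N) + tri (suc N)) + 2 * (3 * Tₓ N + 3 * Tₘ N)   ≡⟨ cong (_+ 2 * (3 * Tₓ N + 3 * Tₘ N)) (a₁-double-sum N) ⟩
  ∑₃ N (λ a b _ → ∑₃ N (λ a′ b′ _ → χ₁ (suc N) (a , b) (a′ , b′))) + 2 * (3 * Tₓ N + 3 * Tₘ N)
                                                                ≡⟨ rows-summed N ⟩
  2 * (3 * T₁ N) + tri (suc N)                                  ∎))
  where
  open ≡-Reasoning
  regroup : ∀ α x m s → 2 * (α + 3 * (x + m)) + s ≡ (2 * α + s) + 2 * (3 * x + 3 * m)
  regroup = solve-∀

-- Closed forms

Mₘ Kₓ P₁ : ℕ → ℕ
Mₘ N = ∑₃ N (λ a b _ → a ⊓ b)
Kₓ m = ∑₂ m (λ a c → tri (a ∸ c))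
P₁ N = ∑₃ N (λ a _ _ → a)

Mₘ-rec : ∀ N → Mₘ (2 + N) ≡ tri (suc N) + Mₘ N
Mₘ-rec N = begin
  Mₘ (2 + N)
    ≡⟨ ∑₃-peel₁₂ N (λ a b _ → a ⊓ b) ⟩
  ∑₂ (2 + N) (λ _ _ → 0) + ∑₂ (suc N) (λ _ _ → 0) + ∑₃ N (λ a b _ → 1 + a ⊓ b)
    ≡⟨ cong₂ (λ s t → s + t + ∑₃ N (λ a b _ → 1 + a ⊓ b)) (∑₂-zero (2 + N)) (∑₂-zero (suc N)) ⟩
  ∑₃ N (λ a b _ → 1 + a ⊓ b)
    ≡⟨ ∑₃-+ N (λ _ _ _ → 1) (λ a b _ → a ⊓ b) ⟩
  ∑₃ N (λ _ _ _ → 1) + Mₘ N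
    ≡⟨ cong (_+ Mₘ N) (∑₃-one N) ⟩
  tri (suc N) + Mₘ N ∎
  where open ≡-Reasoning

Tₘ-rec : ∀ N → Tₘ (2 + N) ≡ tri (suc N) + Mₘ N + Tₘ N
Tₘ-rec N = begin
  Tₘ (2 + N)
    ≡⟨ ∑₃-peel₁₂ N (λ a b _ → tri (a ⊓ b)) ⟩
  ∑₂ (2 + N) (λ _ _ → 0) + ∑₂ (suc N) (λ _ _ → 0) + ∑₃ N (λ a b _ → 1 + a ⊓ b + tri (a ⊓ b))
    ≡⟨ cong₂ (λ s t → s + t + ∑₃ N (λ a b _ → 1 + a ⊓ b + tri (a ⊓ b))) (∑₂-zero (2 + N)) (∑₂-zero (suc N)) ⟩
  ∑₃ N (λ a b _ → 1 + a ⊓ b + tri (a ⊓ b))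
    ≡⟨ ∑₃-+₃ N (λ _ _ _ → 1) (λ a b _ → a ⊓ b) (λ a b _ → tri (a ⊓ b)) ⟩
  ∑₃ N (λ _ _ _ → 1) + Mₘ N + Tₘ N
    ≡⟨ cong (λ s → s + Mₘ N + Tₘ N) (∑₃-one N) ⟩
  tri (suc N) + Mₘ N + Tₘ N ∎
  where open ≡-Reasoning

Tₓ-rec : ∀ N → Tₓ (2 + N) ≡ Kₓ (suc N) + Tₓ N
Tₓ-rec N = trans (∑₃-peel₁₂ N (λ a b c → tri (a ∸ suc (b + c)))) (cong (λ s → s + Kₓ (suc N) + Tₓ N) (∑₂-zero (2 + N)))

Kₓ≡Mₘ+tri : ∀ N → Kₓ (suc N) ≡ Mₘ N + tri (suc N)
Kₓ≡Mₘ+tri zero          = refl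
Kₓ≡Mₘ+tri (suc zero)    = refl
Kₓ≡Mₘ+tri (suc (suc N)) = begin
  Kₓ (3 + N)                       ≡⟨ ∑₂-last (suc N) (λ a c → tri (suc a ∸ c)) ⟩
  Kₓ (suc N) + tri (3 + N)         ≡⟨ cong (_+ tri (3 + N)) (trans (Kₓ≡Mₘ+tri N) (+-comm (Mₘ N) (tri (suc N)))) ⟩
  tri (suc N) + Mₘ N + tri (3 + N) ≡⟨ cong (_+ tri (3 + N)) (sym (Mₘ-rec N)) ⟩
  Mₘ (2 + N) + tri (3 + N)         ∎
  where open ≡-Reasoning

Tₓ≡Tₘ : ∀ N → Tₓ N ≡ Tₘ N
Tₓ≡Tₘ zero          = refl
Tₓ≡Tₘ (suc zero)    = refl
Tₓ≡Tₘ (suc (suc N)) = begin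
  Tₓ (2 + N)                ≡⟨ Tₓ-rec N ⟩
  Kₓ (suc N) + Tₓ N         ≡⟨ cong₂ _+_ (trans (Kₓ≡Mₘ+tri N) (+-comm (Mₘ N) (tri (suc N)))) (Tₓ≡Tₘ N) ⟩
  tri (suc N) + Mₘ N + Tₘ N ≡⟨ sym (Tₘ-rec N) ⟩
  Tₘ (2 + N)                ∎
  where open ≡-Reasoning

a₁+6Tₘ≡3T₁ : ∀ N → a 1 (suc N) + 6 * Tₘ N ≡ 3 * T₁ N
a₁+6Tₘ≡3T₁ N =
  trans (cong (a 1 (suc N) +_) (trans (sym (double (Tₘ N))) (cong (λ t → 3 * (t + Tₘ N)) (sym (Tₓ≡Tₘ N)))))
        (a₁-by-triangle-sums N)
  where
  double : ∀ t → 3 * (t + t) ≡ 6 * t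
  double = solve-∀

2*tri : ∀ n → 2 * tri n ≡ n * suc n
2*tri zero    = refl
2*tri (suc n) = trans (split n (tri n)) (trans (cong (2 * suc n +_) (2*tri n)) (closed n))
  where
  split : ∀ n t → 2 * (suc n + t) ≡ 2 * suc n + 2 * t
  split = solve-∀
  closed : ∀ n → 2 * suc n + n * suc n ≡ suc n * suc (suc n)
  closed = solve-∀

P₁-rec : ∀ N → P₁ (suc N) ≡ tri (suc N) + P₁ N
P₁-rec N = trans (cong (_+ ∑₃ N (λ a _ _ → 1 + a)) (∑₂-zero (suc N)))
  (trans (∑₃-+ N (λ _ _ _ → 1) (λ a _ _ → a)) (cong (_+ P₁ N) (∑₃-one N)))

T₁-rec : ∀ N → T₁ (suc N) ≡ tri (suc N) + P₁ N + T₁ N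
T₁-rec N = trans (cong (_+ ∑₃ N (λ a _ _ → 1 + a + tri a)) (∑₂-zero (suc N)))
  (trans (∑₃-+₃ N (λ _ _ _ → 1) (λ a _ _ → a) (λ a _ _ → tri a)) (cong (λ s → s + P₁ N + T₁ N) (∑₃-one N)))

P₁-closed : ∀ N → 6 * P₁ N ≡ N * suc N * suc (suc N)
P₁-closed zero    = refl
P₁-closed (suc N) = begin
  6 * P₁ (suc N)                                        ≡⟨ cong (6 *_) (P₁-rec N) ⟩
  6 * (tri (suc N) + P₁ N)                              ≡⟨ split (tri (suc N)) (P₁ N) ⟩
  3 * (2 * tri (suc N)) + 6 * P₁ N                      ≡⟨ cong₂ (λ s t → 3 * s + t) (2*tri (suc N)) (P₁-closed N) ⟩
  3 * (suc N * suc (suc N)) + N * suc N * suc (suc N)   ≡⟨ closed N ⟩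
  suc N * suc (suc N) * suc (suc (suc N))               ∎
  where
  open ≡-Reasoning
  split : ∀ t p → 6 * (t + p) ≡ 3 * (2 * t) + 6 * p
  split = solve-∀
  closed : ∀ N → 3 * (suc N * suc (suc N)) + N * suc N * suc (suc N) ≡ suc N * suc (suc N) * suc (suc (suc N))
  closed = solve-∀

T₁-closed : ∀ N → 24 * T₁ N ≡ N * suc N * suc (suc N) * suc (suc (suc N))
T₁-closed zero    = refl
T₁-closed (suc N) = begin
  24 * T₁ (suc N)                                          ≡⟨ cong (24 *_) (T₁-rec N) ⟩
  24 * (tri (suc N) + P₁ N + T₁ N)                         ≡⟨ split (tri (suc N)) (P₁ N) (T₁ N) ⟩
  12 * (2 * tri (suc N)) + 4 * (6 * P₁ N) + 24 * T₁ N
    ≡⟨ cong₂ _+_ (cong₂ (λ s t → 12 * s + 4 * t) (2*tri (suc N)) (P₁-closed N)) (T₁-closed N) ⟩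
  12 * (suc N * suc (suc N)) + 4 * (N * suc N * suc (suc N)) + N * suc N * suc (suc N) * suc (suc (suc N))
                                                           ≡⟨ closed N ⟩
  suc N * suc (suc N) * suc (suc (suc N)) * suc (suc (suc (suc N))) ∎
  where
  open ≡-Reasoning
  split : ∀ t p q → 24 * (t + p + q) ≡ 12 * (2 * t) + 4 * (6 * p) + 24 * q
  split = solve-∀
  closed : ∀ N → 12 * (suc N * suc (suc N)) + 4 * (N * suc N * suc (suc N)) + N * suc N * suc (suc N) * suc (suc (suc N))
               ≡ suc N * suc (suc N) * suc (suc (suc N)) * suc (suc (suc (suc N)))
  closed = solve-∀

Mₘ-even : ∀ k → 6 * Mₘ (k * 2) + k * suc k ≡ 4 * (k * k) * suc k
Mₘ-even zero    = refl
Mₘ-even (suc k) = +-cancelʳ-≡ (k * suc k) _ _ (begin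
  6 * Mₘ (2 + k * 2) + suc k * suc (suc k) + k * suc k
    ≡⟨ cong (λ m → 6 * m + suc k * suc (suc k) + k * suc k) (Mₘ-rec (k * 2)) ⟩
  6 * (tri (suc (k * 2)) + Mₘ (k * 2)) + suc k * suc (suc k) + k * suc k
    ≡⟨ split (tri (suc (k * 2))) (Mₘ (k * 2)) k ⟩
  3 * (2 * tri (suc (k * 2))) + (6 * Mₘ (k * 2) + k * suc k) + suc k * suc (suc k)
    ≡⟨ cong₂ (λ s t → 3 * s + t + suc k * suc (suc k)) (2*tri (suc (k * 2))) (Mₘ-even k) ⟩
  3 * (suc (k * 2) * suc (suc (k * 2))) + 4 * (k * k) * suc k + suc k * suc (suc k)
    ≡⟨ closed k ⟩
  4 * (suc k * suc k) * suc (suc k) + k * suc k ∎)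
  where
  open ≡-Reasoning
  split : ∀ t m k → 6 * (t + m) + suc k * suc (suc k) + k * suc k ≡ 3 * (2 * t) + (6 * m + k * suc k) + suc k * suc (suc k)
  split = solve-∀
  closed : ∀ k → 3 * (suc (k * 2) * suc (suc (k * 2))) + 4 * (k * k) * suc k + suc k * suc (suc k)
               ≡ 4 * (suc k * suc k) * suc (suc k) + k * suc k
  closed = solve-∀

Mₘ-odd : ∀ k → 6 * Mₘ (suc (k * 2)) ≡ k * suc k * (4 * k + 5)
Mₘ-odd zero    = refl
Mₘ-odd (suc k) = begin
  6 * Mₘ (2 + suc (k * 2))
    ≡⟨ cong (6 *_) (Mₘ-rec (suc (k * 2))) ⟩
  6 * (tri (2 + k * 2) + Mₘ (suc (k * 2)))
    ≡⟨ split (tri (2 + k * 2)) (Mₘ (suc (k * 2))) ⟩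
  3 * (2 * tri (2 + k * 2)) + 6 * Mₘ (suc (k * 2))
    ≡⟨ cong₂ (λ s t → 3 * s + t) (2*tri (2 + k * 2)) (Mₘ-odd k) ⟩
  3 * ((2 + k * 2) * suc (2 + k * 2)) + k * suc k * (4 * k + 5)
    ≡⟨ closed k ⟩
  suc k * suc (suc k) * (4 * suc k + 5) ∎
  where
  open ≡-Reasoning
  split : ∀ t m → 6 * (t + m) ≡ 3 * (2 * t) + 6 * m
  split = solve-∀
  closed : ∀ k → 3 * ((2 + k * 2) * suc (2 + k * 2)) + k * suc k * (4 * k + 5) ≡ suc k * suc (suc k) * (4 * suc k + 5)
  closed = solve-∀

Tₘ-even : ∀ k → 6 * Tₘ (k * 2) ≡ k * k * suc k * suc (suc k)
Tₘ-even zero    = refl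
Tₘ-even (suc k) = +-cancelʳ-≡ (k * suc k) _ _ (begin
  6 * Tₘ (2 + k * 2) + k * suc k
    ≡⟨ cong (λ t → 6 * t + k * suc k) (Tₘ-rec (k * 2)) ⟩
  6 * (tri (suc (k * 2)) + Mₘ (k * 2) + Tₘ (k * 2)) + k * suc k
    ≡⟨ split (tri (suc (k * 2))) (Mₘ (k * 2)) (Tₘ (k * 2)) k ⟩
  3 * (2 * tri (suc (k * 2))) + (6 * Mₘ (k * 2) + k * suc k) + 6 * Tₘ (k * 2)
    ≡⟨ cong₂ _+_ (cong₂ (λ s t → 3 * s + t) (2*tri (suc (k * 2))) (Mₘ-even k)) (Tₘ-even k) ⟩
  3 * (suc (k * 2) * suc (suc (k * 2))) + 4 * (k * k) * suc k + k * k * suc k * suc (suc k)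
    ≡⟨ closed k ⟩
  suc k * suc k * suc (suc k) * suc (suc (suc k)) + k * suc k ∎)
  where
  open ≡-Reasoning
  split : ∀ t m x k → 6 * (t + m + x) + k * suc k ≡ 3 * (2 * t) + (6 * m + k * suc k) + 6 * x
  split = solve-∀
  closed : ∀ k → 3 * (suc (k * 2) * suc (suc (k * 2))) + 4 * (k * k) * suc k + k * k * suc k * suc (suc k)
               ≡ suc k * suc k * suc (suc k) * suc (suc (suc k)) + k * suc k
  closed = solve-∀

Tₘ-odd : ∀ k → 6 * Tₘ (suc (k * 2)) ≡ k * suc k * (suc (suc k) * suc (suc k))
Tₘ-odd zero    = refl
Tₘ-odd (suc k) = begin
  6 * Tₘ (2 + suc (k * 2))
    ≡⟨ cong (6 *_) (Tₘ-rec (suc (k * 2))) ⟩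
  6 * (tri (2 + k * 2) + Mₘ (suc (k * 2)) + Tₘ (suc (k * 2)))
    ≡⟨ split (tri (2 + k * 2)) (Mₘ (suc (k * 2))) (Tₘ (suc (k * 2))) ⟩
  3 * (2 * tri (2 + k * 2)) + 6 * Mₘ (suc (k * 2)) + 6 * Tₘ (suc (k * 2))
    ≡⟨ cong₂ _+_ (cong₂ (λ s t → 3 * s + t) (2*tri (2 + k * 2)) (Mₘ-odd k)) (Tₘ-odd k) ⟩
  3 * ((2 + k * 2) * suc (2 + k * 2)) + k * suc k * (4 * k + 5) + k * suc k * (suc (suc k) * suc (suc k))
    ≡⟨ closed k ⟩
  suc k * suc (suc k) * (suc (suc (suc k)) * suc (suc (suc k))) ∎
  where
  open ≡-Reasoning
  split : ∀ t m x → 6 * (t + m + x) ≡ 3 * (2 * t) + 6 * m + 6 * x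
  split = solve-∀
  closed : ∀ k → 3 * ((2 + k * 2) * suc (2 + k * 2)) + k * suc k * (4 * k + 5) + k * suc k * (suc (suc k) * suc (suc k))
               ≡ suc k * suc (suc k) * (suc (suc (suc k)) * suc (suc (suc k)))
  closed = solve-∀

16*a₁-from-closed-forms : ∀ N {m r} → 6 * Tₘ N ≡ m → r + 16 * m ≡ 2 * (N * suc N * suc (suc N) * suc (suc (suc N))) →
  16 * a 1 (suc N) ≡ r
16*a₁-from-closed-forms N {m} {r} 6Tₘ≡m r+16m≡ = +-cancelʳ-≡ (16 * m) _ _ (begin
  16 * a 1 (suc N) + 16 * m            ≡⟨ cong (λ t → 16 * a 1 (suc N) + 16 * t) (sym 6Tₘ≡m) ⟩
  16 * a 1 (suc N) + 16 * (6 * Tₘ N)   ≡⟨ *-distribˡ-+ 16 (a 1 (suc N)) (6 * Tₘ N) ⟨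
  16 * (a 1 (suc N) + 6 * Tₘ N)        ≡⟨ cong (16 *_) (a₁+6Tₘ≡3T₁ N) ⟩
  16 * (3 * T₁ N)                      ≡⟨ rescale (T₁ N) ⟩
  2 * (24 * T₁ N)                      ≡⟨ cong (2 *_) (T₁-closed N) ⟩
  2 * (N * suc N * suc (suc N) * suc (suc (suc N))) ≡⟨ r+16m≡ ⟨
  r + 16 * m                           ∎)
  where
  open ≡-Reasoning
  rescale : ∀ t → 16 * (3 * t) ≡ 2 * (24 * t)
  rescale = solve-∀

a₁-odd : ∀ {n} k → n ≡ suc (k * 2) → 16 * a 1 n ≡ (n * n ∸ 1) * (n * n + 2 * n + 3)
a₁-odd k refl = 16*a₁-from-closed-forms (k * 2) (Tₘ-even k) (polynomial k)
  where
  -- n * n ∸ 1 computes to k * 2 + k * 2 * suc (k * 2), which the ring solver can handle.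
  polynomial : ∀ k → (k * 2 + k * 2 * suc (k * 2)) * (suc (k * 2) * suc (k * 2) + 2 * suc (k * 2) + 3)
                       + 16 * (k * k * suc k * suc (suc k))
                     ≡ 2 * (k * 2 * suc (k * 2) * suc (suc (k * 2)) * suc (suc (suc (k * 2))))
  polynomial = solve-∀

a₁-even : ∀ {n} k → n ≡ suc (suc (k * 2)) → 16 * a 1 n ≡ n * (n + 2) * (n * n + 2)
a₁-even k refl = 16*a₁-from-closed-forms (suc (k * 2)) (Tₘ-odd k) (polynomial k)
  where
  polynomial : ∀ k → suc (suc (k * 2)) * (suc (suc (k * 2)) + 2) * (suc (suc (k * 2)) * suc (suc (k * 2)) + 2)
                       + 16 * (k * suc k * (suc (suc k) * suc (suc k)))
                     ≡ 2 * (suc (k * 2) * suc (suc (k * 2)) * suc (suc (suc (k * 2))) * suc (suc (suc (suc (k * 2)))))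
  polynomial = solve-∀

mainTheorem8 : (n : ℕ) → 1 ≤ n →
    (n % 2 ≡ 1 → 16 * a 1 n ≡ (n * n ∸ 1) * (n * n + 2 * n + 3)) ×
    (n % 2 ≡ 0 → 16 * a 1 n ≡ n * (n + 2) * (n * n + 2))
mainTheorem8 n 1≤n =
  (λ n%2≡1 → a₁-odd (n / 2) (n≡[n%2]+[n/2]*2 n%2≡1)) , (λ n%2≡0 → even (n / 2) (n≡[n%2]+[n/2]*2 n%2≡0))
  where
  n≡[n%2]+[n/2]*2 : ∀ {r} → n % 2 ≡ r → n ≡ r + n / 2 * 2
  n≡[n%2]+[n/2]*2 n%2≡r = trans (m≡m%n+[m/n]*n n 2) (cong (_+ n / 2 * 2) n%2≡r)
  even : ∀ k → n ≡ k * 2 → 16 * a 1 n ≡ n * (n + 2) * (n * n + 2)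
  even zero    n≡0 = contradiction (subst (1 ≤_) n≡0 1≤n) (λ ())
  even (suc k) n≡  = a₁-even k n≡
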